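{- Over the rules of $\mathbb{T}_\omega$, for every $n\ge 0$: (1) $\mathrm{TR}_n$ implies $\mathrm{OUP}_n$; (2) $\mathrm{TR}_n$ implies $\mathrm{UIP}_{n+1}$; (3) $\mathrm{UIP}_n$ implies $\mathrm{TR}_n$. (Here "$X$ implies $Y$" means every instance of rule $Y$ is derivable in $\mathbb{T}_\omega$ extended by rule $X$.)
   Context: $\mathbb{T}_\omega$ is intensional Martin-Löf type theory with dependent products, dependent sums, natural numbers and intensional identity types $\mathrm{Id}_A(a,b)$ with reflexivity $\mathrm{r}$ and eliminator $J$. Iterated identity types: $\mathrm{Id}^0_A:=A$, $\mathrm{Id}^{1}_A(a,b):=\mathrm{Id}_A(a,b)$, and $\mathrm{Id}^{n+1}_A(a_1,b_1;\dots;a_{n+1},b_{n+1}):=\mathrm{Id}_{\mathrm{Id}^n_A(a_1,b_1;\dots;a_n,b_n)}(a_{n+1},b_{n+1})$. Rules, for $a_{n+1},b_{n+1}:\mathrm{Id}^n_A(a_1,b_1;\dots;a_n,b_n)$: $\mathrm{TR}_n$: from $p:\mathrm{Id}^{n+1}_A(a_1,b_1;\dots;a_{n+1},b_{n+1})$ infer $a_{n+1}=b_{n+1}:\mathrm{Id}^n_A(a_1,b_1;\dots;a_n,b_n)$ (definitional equality). $\mathrm{UIP}_n$: infer $a_{n+1}=b_{n+1}:\mathrm{Id}^n_A(a_1,b_1;\dots;a_n,b_n)$ outright. $\mathrm{OUP}_n$: from $a_{n+1}:\mathrm{Id}^n_A(a_1,b_1;\dots;a_n,b_n)$ and $p:\mathrm{Id}^{n+1}_A(a_1,b_1;\dots;a_{n+1},a_{n+1})$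 infer $p=\mathrm{r}(a_{n+1})$. -}

module Defs where

-- A deep embedding of the type theory T_ω (intensional Martin-Löf type theory
-- with Π, Σ, ℕ and intensional identity types), with well-scoped de Bruijn
-- syntax, and its extension by one of the rules TR_n, UIP_n, OUP_n.

open import Data.Nat using (ℕ; zero; suc)
open import Data.Fin using (Fin; zero; suc)
open import Data.Product using (_×_; _,_)
open import Relation.Binary.PropositionalEquality using (_≡_)

-- Raw syntax (m = number of free variables; var zero = innermost)

mutual
  data Ty (m : ℕ) : Set where
    Π   : Ty m → Ty (suc m) → Ty m
    Σ   : Ty m → Ty (suc m) → Ty m
    Nat : Ty m
    Id  : Ty m → Tm m → Tm m → Ty m

  data Tm (m : ℕ) : Set where
    var    : Fin m → Tm m
    lam    : Tm (suc m) → Tm m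
    app    : Tm m → Tm m → Tm m
    pair   : Tm m → Tm m → Tm m
    -- split C d t : Σ-eliminator, motive C over z : Σ A B, d over x : A, y : B
    split  : Ty (suc m) → Tm (suc (suc m)) → Tm m → Tm m
    ze     : Tm m
    su     : Tm m → Tm m
    -- natrec C z s t : motive C over n : ℕ, step s over n : ℕ, c : C
    natrec : Ty (suc m) → Tm m → Tm (suc (suc m)) → Tm m → Tm m
    r      : Tm m → Tm m
    -- J C d a b p : motive C over x y : A, u : Id A x y ; d over x : A
    J      : Ty (suc (suc (suc m))) → Tm (suc m) → Tm m → Tm m → Tm m → Tm m

Ren : ℕ → ℕ → Set
Ren m k = Fin m → Fin k

liftR : ∀ {m k} → Ren m k → Ren (suc m) (suc k)
liftR ρ zero    = zero
liftR ρ (suc i) = suc (ρ i)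

mutual
  renTy : ∀ {m k} → Ren m k → Ty m → Ty k
  renTy ρ (Π A B)    = Π (renTy ρ A) (renTy (liftR ρ) B)
  renTy ρ (Σ A B)    = Σ (renTy ρ A) (renTy (liftR ρ) B)
  renTy ρ Nat        = Nat
  renTy ρ (Id A a b) = Id (renTy ρ A) (renTm ρ a) (renTm ρ b)

  renTm : ∀ {m k} → Ren m k → Tm m → Tm k
  renTm ρ (var i)            = var (ρ i)
  renTm ρ (lam t)            = lam (renTm (liftR ρ) t)
  renTm ρ (app t u)          = app (renTm ρ t) (renTm ρ u)
  renTm ρ (pair t u)         = pair (renTm ρ t) (renTm ρ u)
  renTm ρ (split C d t)      = split (renTy (liftR ρ) C) (renTm (liftR (liftR ρ)) d) (renTm ρ t)
  renTm ρ ze                 = ze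
  renTm ρ (su t)             = su (renTm ρ t)
  renTm ρ (natrec C z s t)   = natrec (renTy (liftR ρ) C) (renTm ρ z) (renTm (liftR (liftR ρ)) s) (renTm ρ t)
  renTm ρ (r t)              = r (renTm ρ t)
  renTm ρ (J C d a b p)      = J (renTy (liftR (liftR (liftR ρ))) C) (renTm (liftR ρ) d)
                                 (renTm ρ a) (renTm ρ b) (renTm ρ p)

wkTy : ∀ {m} → Ty m → Ty (suc m)
wkTy = renTy suc

wkTm : ∀ {m} → Tm m → Tm (suc m)
wkTm = renTm suc

Sub : ℕ → ℕ → Set
Sub m k = Fin m → Tm k

liftS : ∀ {m k} → Sub m k → Sub (suc m) (suc k)
liftS σ zero    = var zero
liftS σ (suc i) = wkTm (σ i)

mutual
  subTy : ∀ {m k} → Sub m k → Ty m → Ty k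
  subTy σ (Π A B)    = Π (subTy σ A) (subTy (liftS σ) B)
  subTy σ (Σ A B)    = Σ (subTy σ A) (subTy (liftS σ) B)
  subTy σ Nat        = Nat
  subTy σ (Id A a b) = Id (subTy σ A) (subTm σ a) (subTm σ b)

  subTm : ∀ {m k} → Sub m k → Tm m → Tm k
  subTm σ (var i)            = σ i
  subTm σ (lam t)            = lam (subTm (liftS σ) t)
  subTm σ (app t u)          = app (subTm σ t) (subTm σ u)
  subTm σ (pair t u)         = pair (subTm σ t) (subTm σ u)
  subTm σ (split C d t)      = split (subTy (liftS σ) C) (subTm (liftS (liftS σ)) d) (subTm σ t)
  subTm σ ze                 = ze
  subTm σ (su t)             = su (subTm σ t)
  subTm σ (natrec C z s t)   = natrec (subTy (liftS σ) C) (subTm σ z) (subTm (liftS (liftS σ)) s) (subTm σ t)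
  subTm σ (r t)              = r (subTm σ t)
  subTm σ (J C d a b p)      = J (subTy (liftS (liftS (liftS σ))) C) (subTm (liftS σ) d)
                                 (subTm σ a) (subTm σ b) (subTm σ p)

_,ˢ_ : ∀ {m k} → Sub m k → Tm k → Sub (suc m) k
(σ ,ˢ t) zero    = t
(σ ,ˢ t) (suc i) = σ i

idS : ∀ {m} → Sub m m
idS = var

wk1S : ∀ {m} → Sub m (suc m)
wk1S i = var (suc i)

wk2S : ∀ {m} → Sub m (suc (suc m))
wk2S i = var (suc (suc i))

_[_]₀ : ∀ {m} → Ty (suc m) → Tm m → Ty m
B [ a ]₀ = subTy (idS ,ˢ a) B

_[_]ₜ : ∀ {m} → Tm (suc m) → Tm m → Tm m
t [ a ]ₜ = subTm (idS ,ˢ a) t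

data Ctx : ℕ → Set where
  ε   : Ctx zero
  _▹_ : ∀ {m} → Ctx m → Ty m → Ctx (suc m)

lookup : ∀ {m} → Ctx m → Fin m → Ty m
lookup (Γ ▹ A) zero    = wkTy A
lookup (Γ ▹ A) (suc i) = wkTy (lookup Γ i)

data Tel (m : ℕ) : ℕ → Set where
  []  : Tel m zero
  _▷_ : ∀ {n} → Tel m n → Tm m × Tm m → Tel m (suc n)

-- IdIter A (a₁,b₁;…;aₙ,bₙ) = Id^n_A(a₁,b₁;…;aₙ,bₙ)
IdIter : ∀ {m n} → Ty m → Tel m n → Ty m
IdIter A []             = A
IdIter A (t ▷ (a , b))  = Id (IdIter A t) a b

data Ext : Set where
  TR UIP OUP : ℕ → Ext

-- motive-instantiation helpers
-- C over (Γ, z : Σ A B) instantiated at z := pair x y in (Γ, x : A, y : B)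
splitMotive : ∀ {m} → Ty (suc m) → Ty (suc (suc m))
splitMotive C = subTy (wk2S ,ˢ pair (var (suc zero)) (var zero)) C

-- C over (Γ, n : ℕ) instantiated at n := suc n in (Γ, n : ℕ, c : C)
natrecMotive : ∀ {m} → Ty (suc m) → Ty (suc (suc m))
natrecMotive C = subTy (wk2S ,ˢ su (var (suc zero))) C

-- C over (Γ, x, y, u) instantiated at x, x, r x in (Γ, x : A)
JMotive : ∀ {m} → Ty (suc (suc (suc m))) → Ty (suc m)
JMotive C = subTy (((wk1S ,ˢ var zero) ,ˢ var zero) ,ˢ r (var zero)) C

_[_,_,_]₃ : ∀ {m} → Ty (suc (suc (suc m))) → Tm m → Tm m → Tm m → Ty m
C [ a , b , p ]₃ = subTy (((idS ,ˢ a) ,ˢ b) ,ˢ p) C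

_[_,_]₂ : ∀ {m} → Tm (suc (suc m)) → Tm m → Tm m → Tm m
d [ a , b ]₂ = subTm ((idS ,ˢ a) ,ˢ b) d

JCtx : ∀ {m} → Ctx m → Ty m → Ctx (suc (suc (suc m)))
JCtx Γ A = ((Γ ▹ A) ▹ wkTy A) ▹ Id (wkTy (wkTy A)) (var (suc zero)) (var zero)

mutual
  data WfC (X : Ext) : ∀ {m} → Ctx m → Set where
    ε-wf : WfC X ε
    ▹-wf : ∀ {m} {Γ : Ctx m} {A} → WfC X Γ → WfT X Γ A → WfC X (Γ ▹ A)

  data WfT (X : Ext) : ∀ {m} → Ctx m → Ty m → Set where
    Π-F   : ∀ {m} {Γ : Ctx m} {A B} → WfT X Γ A → WfT X (Γ ▹ A) B → WfT X Γ (Π A B)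
    Σ-F   : ∀ {m} {Γ : Ctx m} {A B} → WfT X Γ A → WfT X (Γ ▹ A) B → WfT X Γ (Σ A B)
    Nat-F : ∀ {m} {Γ : Ctx m} → WfC X Γ → WfT X Γ Nat
    Id-F  : ∀ {m} {Γ : Ctx m} {A a b} → WfT X Γ A → HasTy X Γ a A → HasTy X Γ b A → WfT X Γ (Id A a b)

  data HasTy (X : Ext) : ∀ {m} → Ctx m → Tm m → Ty m → Set where
    var-I  : ∀ {m} {Γ : Ctx m} (i : Fin m) → WfC X Γ → HasTy X Γ (var i) (lookup Γ i)
    conv   : ∀ {m} {Γ : Ctx m} {t A B} → HasTy X Γ t A → EqT X Γ A B → HasTy X Γ t B
    Π-I    : ∀ {m} {Γ : Ctx m} {A B t} → WfT X Γ A → HasTy X (Γ ▹ A) t B → HasTy X Γ (lam t) (Π A B)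
    Π-E    : ∀ {m} {Γ : Ctx m} {A B f a} → HasTy X Γ f (Π A B) → HasTy X Γ a A → HasTy X Γ (app f a) (B [ a ]₀)
    Σ-I    : ∀ {m} {Γ : Ctx m} {A B a b} → WfT X (Γ ▹ A) B → HasTy X Γ a A → HasTy X Γ b (B [ a ]₀)
             → HasTy X Γ (pair a b) (Σ A B)
    Σ-E    : ∀ {m} {Γ : Ctx m} {A B C d t} → WfT X (Γ ▹ Σ A B) C
             → HasTy X ((Γ ▹ A) ▹ B) d (splitMotive C) → HasTy X Γ t (Σ A B)
             → HasTy X Γ (split C d t) (C [ t ]₀)
    Nat-I₀ : ∀ {m} {Γ : Ctx m} → WfC X Γ → HasTy X Γ ze Nat
    Nat-I₁ : ∀ {m} {Γ : Ctx m} {t} → HasTy X Γ t Nat → HasTy X Γ (su t) Nat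
    Nat-E  : ∀ {m} {Γ : Ctx m} {C z s t} → WfT X (Γ ▹ Nat) C → HasTy X Γ z (C [ ze ]₀)
             → HasTy X ((Γ ▹ Nat) ▹ C) s (natrecMotive C) → HasTy X Γ t Nat
             → HasTy X Γ (natrec C z s t) (C [ t ]₀)
    Id-I   : ∀ {m} {Γ : Ctx m} {A a} → HasTy X Γ a A → HasTy X Γ (r a) (Id A a a)
    Id-E   : ∀ {m} {Γ : Ctx m} {A C d a b p} → WfT X (JCtx Γ A) C
             → HasTy X (Γ ▹ A) d (JMotive C) → HasTy X Γ a A → HasTy X Γ b A
             → HasTy X Γ p (Id A a b) → HasTy X Γ (J C d a b p) (C [ a , b , p ]₃)

  data EqT (X : Ext) : ∀ {m} → Ctx m → Ty m → Ty m → Set where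
    reflT  : ∀ {m} {Γ : Ctx m} {A} → WfT X Γ A → EqT X Γ A A
    symT   : ∀ {m} {Γ : Ctx m} {A B} → EqT X Γ A B → EqT X Γ B A
    transT : ∀ {m} {Γ : Ctx m} {A B C} → EqT X Γ A B → EqT X Γ B C → EqT X Γ A C
    Π-cong : ∀ {m} {Γ : Ctx m} {A A' B B'} → WfT X Γ A → EqT X Γ A A' → EqT X (Γ ▹ A) B B'
             → EqT X Γ (Π A B) (Π A' B')
    Σ-cong : ∀ {m} {Γ : Ctx m} {A A' B B'} → WfT X Γ A → EqT X Γ A A' → EqT X (Γ ▹ A) B B'
             → EqT X Γ (Σ A B) (Σ A' B')
    Id-cong : ∀ {m} {Γ : Ctx m} {A A' a a' b b'} → EqT X Γ A A' → EqTm X Γ a a' A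
              → EqTm X Γ b b' A → EqT X Γ (Id A a b) (Id A' a' b')

  data EqTm (X : Ext) : ∀ {m} → Ctx m → Tm m → Tm m → Ty m → Set where
    reflE  : ∀ {m} {Γ : Ctx m} {t A} → HasTy X Γ t A → EqTm X Γ t t A
    symE   : ∀ {m} {Γ : Ctx m} {t u A} → EqTm X Γ t u A → EqTm X Γ u t A
    transE : ∀ {m} {Γ : Ctx m} {t u v A} → EqTm X Γ t u A → EqTm X Γ u v A → EqTm X Γ t v A
    convE  : ∀ {m} {Γ : Ctx m} {t u A B} → EqTm X Γ t u A → EqT X Γ A B → EqTm X Γ t u B
    lam-cong  : ∀ {m} {Γ : Ctx m} {A B t t'} → WfT X Γ A → EqTm X (Γ ▹ A) t t' B
                → EqTm X Γ (lam t) (lam t') (Π A B)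
    app-cong  : ∀ {m} {Γ : Ctx m} {A B f f' a a'} → EqTm X Γ f f' (Π A B) → EqTm X Γ a a' A
                → EqTm X Γ (app f a) (app f' a') (B [ a ]₀)
    pair-cong : ∀ {m} {Γ : Ctx m} {A B a a' b b'} → WfT X (Γ ▹ A) B → EqTm X Γ a a' A
                → EqTm X Γ b b' (B [ a ]₀) → EqTm X Γ (pair a b) (pair a' b') (Σ A B)
    split-cong : ∀ {m} {Γ : Ctx m} {A B C C' d d' t t'} → WfT X (Γ ▹ Σ A B) C
                 → EqT X (Γ ▹ Σ A B) C C' → EqTm X ((Γ ▹ A) ▹ B) d d' (splitMotive C)
                 → EqTm X Γ t t' (Σ A B) → EqTm X Γ (split C d t) (split C' d' t') (C [ t ]₀)
    su-cong   : ∀ {m} {Γ : Ctx m} {t t'} → EqTm X Γ t t' Nat → EqTm X Γ (su t) (su t') Nat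
    natrec-cong : ∀ {m} {Γ : Ctx m} {C C' z z' s s' t t'} → WfT X (Γ ▹ Nat) C
                  → EqT X (Γ ▹ Nat) C C' → EqTm X Γ z z' (C [ ze ]₀)
                  → EqTm X ((Γ ▹ Nat) ▹ C) s s' (natrecMotive C) → EqTm X Γ t t' Nat
                  → EqTm X Γ (natrec C z s t) (natrec C' z' s' t') (C [ t ]₀)
    r-cong    : ∀ {m} {Γ : Ctx m} {A a a'} → EqTm X Γ a a' A → EqTm X Γ (r a) (r a') (Id A a a)
    J-cong    : ∀ {m} {Γ : Ctx m} {A C C' d d' a a' b b' p p'} → WfT X (JCtx Γ A) C
                → EqT X (JCtx Γ A) C C' → EqTm X (Γ ▹ A) d d' (JMotive C)
                → EqTm X Γ a a' A → EqTm X Γ b b' A → EqTm X Γ p p' (Id A a b)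
                → EqTm X Γ (J C d a b p) (J C' d' a' b' p') (C [ a , b , p ]₃)
    Π-β   : ∀ {m} {Γ : Ctx m} {A B t a} → WfT X Γ A → HasTy X (Γ ▹ A) t B → HasTy X Γ a A
            → EqTm X Γ (app (lam t) a) (t [ a ]ₜ) (B [ a ]₀)
    Σ-β   : ∀ {m} {Γ : Ctx m} {A B C d a b} → WfT X (Γ ▹ Σ A B) C
            → HasTy X ((Γ ▹ A) ▹ B) d (splitMotive C) → HasTy X Γ a A → HasTy X Γ b (B [ a ]₀)
            → EqTm X Γ (split C d (pair a b)) (d [ a , b ]₂) (C [ pair a b ]₀)
    Nat-β₀ : ∀ {m} {Γ : Ctx m} {C z s} → WfT X (Γ ▹ Nat) C → HasTy X Γ z (C [ ze ]₀)
             → HasTy X ((Γ ▹ Nat) ▹ C) s (natrecMotive C)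
             → EqTm X Γ (natrec C z s ze) z (C [ ze ]₀)
    Nat-β₁ : ∀ {m} {Γ : Ctx m} {C z s t} → WfT X (Γ ▹ Nat) C → HasTy X Γ z (C [ ze ]₀)
             → HasTy X ((Γ ▹ Nat) ▹ C) s (natrecMotive C) → HasTy X Γ t Nat
             → EqTm X Γ (natrec C z s (su t)) (s [ t , natrec C z s t ]₂) (C [ su t ]₀)
    Id-β  : ∀ {m} {Γ : Ctx m} {A C d a} → WfT X (JCtx Γ A) C
            → HasTy X (Γ ▹ A) d (JMotive C) → HasTy X Γ a A
            → EqTm X Γ (J C d a a (r a)) (d [ a ]ₜ) (C [ a , a , r a ]₃)
    TR-rule  : ∀ {n m} {Γ : Ctx m} {A} {tel : Tel m n} {a b p} → X ≡ TR n
               → HasTy X Γ a (IdIter A tel) → HasTy X Γ b (IdIter A tel)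
               → HasTy X Γ p (IdIter A (tel ▷ (a , b)))
               → EqTm X Γ a b (IdIter A tel)
    UIP-rule : ∀ {n m} {Γ : Ctx m} {A} {tel : Tel m n} {a b} → X ≡ UIP n
               → HasTy X Γ a (IdIter A tel) → HasTy X Γ b (IdIter A tel)
               → EqTm X Γ a b (IdIter A tel)
    OUP-rule : ∀ {n m} {Γ : Ctx m} {A} {tel : Tel m n} {a p} → X ≡ OUP n
               → HasTy X Γ a (IdIter A tel)
               → HasTy X Γ p (IdIter A (tel ▷ (a , a)))
               → EqTm X Γ p (r a) (IdIter A (tel ▷ (a , a)))

TRHolds : Ext → ℕ → Set
TRHolds X n = ∀ {m} {Γ : Ctx m} {A} {tel : Tel m n} {a b p}
  → HasTy X Γ a (IdIter A tel) → HasTy X Γ b (IdIter A tel)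
  → HasTy X Γ p (IdIter A (tel ▷ (a , b)))
  → EqTm X Γ a b (IdIter A tel)

UIPHolds : Ext → ℕ → Set
UIPHolds X n = ∀ {m} {Γ : Ctx m} {A} {tel : Tel m n} {a b}
  → HasTy X Γ a (IdIter A tel) → HasTy X Γ b (IdIter A tel)
  → EqTm X Γ a b (IdIter A tel)

OUPHolds : Ext → ℕ → Set
OUPHolds X n = ∀ {m} {Γ : Ctx m} {A} {tel : Tel m n} {a p}
  → HasTy X Γ a (IdIter A tel)
  → HasTy X Γ p (IdIter A (tel ▷ (a , a)))
  → EqTm X Γ p (r a) (IdIter A (tel ▷ (a , a)))

-- (3) is immediate, since UIP_n equates any two terms outright. TR_n entails TR at every
-- higher level, because Id^{k+1}_A(a₁,b₁;…) is Id^k over the base type Id_A(a₁,b₁). For (1),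
-- path induction with motive Id (Id T x y) u (r x) shows that a loop p : Id T a a is
-- propositionally equal to r a, and TR_{n+1} turns this into a judgemental equality; the motive
-- only typechecks because TR_n already makes x and y judgementally equal. For (2), TR_n makes
-- the endpoints of two paths in Id^{n+1} equal, so both are loops and hence equal to r by (1).

module Submission where

open import Defs
open import Data.Nat using (ℕ; suc)
open import Data.Fin using (Fin; zero; suc)
open import Data.Product using (∃; _×_; _,_; proj₁; proj₂)
open import Function.Nary.NonDependent using (congₙ)
open import Relation.Binary.PropositionalEquality using (_≡_; refl; sym; trans; cong; cong₂)

liftR-∘ : ∀ {m k l} {ρ : Ren k l} {ρ′ : Ren m k} {ρ″ : Ren m l} →
          (∀ i → ρ (ρ′ i) ≡ ρ″ i) → ∀ i → liftR ρ (liftR ρ′ i) ≡ liftR ρ″ i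
liftR-∘ h zero    = refl
liftR-∘ h (suc i) = cong suc (h i)

mutual
  renTy-∘ : ∀ {m k l} {ρ : Ren k l} {ρ′ : Ren m k} {ρ″ : Ren m l} →
            (∀ i → ρ (ρ′ i) ≡ ρ″ i) → ∀ A → renTy ρ (renTy ρ′ A) ≡ renTy ρ″ A
  renTy-∘ h (Π A B)    = cong₂ Π (renTy-∘ h A) (renTy-∘ (liftR-∘ h) B)
  renTy-∘ h (Σ A B)    = cong₂ Σ (renTy-∘ h A) (renTy-∘ (liftR-∘ h) B)
  renTy-∘ h Nat        = refl
  renTy-∘ h (Id A a b) = congₙ 3 Id (renTy-∘ h A) (renTm-∘ h a) (renTm-∘ h b)

  renTm-∘ : ∀ {m k l} {ρ : Ren k l} {ρ′ : Ren m k} {ρ″ : Ren m l} →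
            (∀ i → ρ (ρ′ i) ≡ ρ″ i) → ∀ t → renTm ρ (renTm ρ′ t) ≡ renTm ρ″ t
  renTm-∘ h (var i)          = cong var (h i)
  renTm-∘ h (lam t)          = cong lam (renTm-∘ (liftR-∘ h) t)
  renTm-∘ h (app t u)        = cong₂ app (renTm-∘ h t) (renTm-∘ h u)
  renTm-∘ h (pair t u)       = cong₂ pair (renTm-∘ h t) (renTm-∘ h u)
  renTm-∘ h (split C d t)    = congₙ 3 split (renTy-∘ (liftR-∘ h) C)
                                 (renTm-∘ (liftR-∘ (liftR-∘ h)) d) (renTm-∘ h t)
  renTm-∘ h ze               = refl
  renTm-∘ h (su t)           = cong su (renTm-∘ h t)
  renTm-∘ h (natrec C z s t) = congₙ 4 natrec (renTy-∘ (liftR-∘ h) C) (renTm-∘ h z)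
                                 (renTm-∘ (liftR-∘ (liftR-∘ h)) s) (renTm-∘ h t)
  renTm-∘ h (r t)            = cong r (renTm-∘ h t)
  renTm-∘ h (J C d a b p)    = congₙ 5 J (renTy-∘ (liftR-∘ (liftR-∘ (liftR-∘ h))) C)
                                 (renTm-∘ (liftR-∘ h) d) (renTm-∘ h a) (renTm-∘ h b) (renTm-∘ h p)

liftS-liftR : ∀ {m k l} {σ : Sub k l} {ρ : Ren m k} {τ : Sub m l} →
              (∀ i → σ (ρ i) ≡ τ i) → ∀ i → liftS σ (liftR ρ i) ≡ liftS τ i
liftS-liftR h zero    = refl
liftS-liftR h (suc i) = cong wkTm (h i)

mutual
  subTy-renTy : ∀ {m k l} {σ : Sub k l} {ρ : Ren m k} {τ : Sub m l} →
                (∀ i → σ (ρ i) ≡ τ i) → ∀ A → subTy σ (renTy ρ A) ≡ subTy τ A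
  subTy-renTy h (Π A B)    = cong₂ Π (subTy-renTy h A) (subTy-renTy (liftS-liftR h) B)
  subTy-renTy h (Σ A B)    = cong₂ Σ (subTy-renTy h A) (subTy-renTy (liftS-liftR h) B)
  subTy-renTy h Nat        = refl
  subTy-renTy h (Id A a b) = congₙ 3 Id (subTy-renTy h A) (subTm-renTm h a) (subTm-renTm h b)

  subTm-renTm : ∀ {m k l} {σ : Sub k l} {ρ : Ren m k} {τ : Sub m l} →
                (∀ i → σ (ρ i) ≡ τ i) → ∀ t → subTm σ (renTm ρ t) ≡ subTm τ t
  subTm-renTm h (var i)          = h i
  subTm-renTm h (lam t)          = cong lam (subTm-renTm (liftS-liftR h) t)
  subTm-renTm h (app t u)        = cong₂ app (subTm-renTm h t) (subTm-renTm h u)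
  subTm-renTm h (pair t u)       = cong₂ pair (subTm-renTm h t) (subTm-renTm h u)
  subTm-renTm h (split C d t)    = congₙ 3 split (subTy-renTy (liftS-liftR h) C)
                                     (subTm-renTm (liftS-liftR (liftS-liftR h)) d) (subTm-renTm h t)
  subTm-renTm h ze               = refl
  subTm-renTm h (su t)           = cong su (subTm-renTm h t)
  subTm-renTm h (natrec C z s t) = congₙ 4 natrec (subTy-renTy (liftS-liftR h) C) (subTm-renTm h z)
                                     (subTm-renTm (liftS-liftR (liftS-liftR h)) s) (subTm-renTm h t)
  subTm-renTm h (r t)            = cong r (subTm-renTm h t)
  subTm-renTm h (J C d a b p)    = congₙ 5 J (subTy-renTy (liftS-liftR (liftS-liftR (liftS-liftR h))) C)
                                     (subTm-renTm (liftS-liftR h) d) (subTm-renTm h a)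
                                     (subTm-renTm h b) (subTm-renTm h p)

liftR-liftS : ∀ {m k l} {ρ : Ren k l} {σ : Sub m k} {τ : Sub m l} →
              (∀ i → renTm ρ (σ i) ≡ τ i) → ∀ i → renTm (liftR ρ) (liftS σ i) ≡ liftS τ i
liftR-liftS h zero = refl
liftR-liftS {σ = σ} h (suc i) =
  trans (renTm-∘ (λ _ → refl) (σ i)) (trans (sym (renTm-∘ (λ _ → refl) (σ i))) (cong wkTm (h i)))

mutual
  renTy-subTy : ∀ {m k l} {ρ : Ren k l} {σ : Sub m k} {τ : Sub m l} →
                (∀ i → renTm ρ (σ i) ≡ τ i) → ∀ A → renTy ρ (subTy σ A) ≡ subTy τ A
  renTy-subTy h (Π A B)    = cong₂ Π (renTy-subTy h A) (renTy-subTy (liftR-liftS h) B)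
  renTy-subTy h (Σ A B)    = cong₂ Σ (renTy-subTy h A) (renTy-subTy (liftR-liftS h) B)
  renTy-subTy h Nat        = refl
  renTy-subTy h (Id A a b) = congₙ 3 Id (renTy-subTy h A) (renTm-subTm h a) (renTm-subTm h b)

  renTm-subTm : ∀ {m k l} {ρ : Ren k l} {σ : Sub m k} {τ : Sub m l} →
                (∀ i → renTm ρ (σ i) ≡ τ i) → ∀ t → renTm ρ (subTm σ t) ≡ subTm τ t
  renTm-subTm h (var i)          = h i
  renTm-subTm h (lam t)          = cong lam (renTm-subTm (liftR-liftS h) t)
  renTm-subTm h (app t u)        = cong₂ app (renTm-subTm h t) (renTm-subTm h u)
  renTm-subTm h (pair t u)       = cong₂ pair (renTm-subTm h t) (renTm-subTm h u)
  renTm-subTm h (split C d t)    = congₙ 3 split (renTy-subTy (liftR-liftS h) C)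
                                     (renTm-subTm (liftR-liftS (liftR-liftS h)) d) (renTm-subTm h t)
  renTm-subTm h ze               = refl
  renTm-subTm h (su t)           = cong su (renTm-subTm h t)
  renTm-subTm h (natrec C z s t) = congₙ 4 natrec (renTy-subTy (liftR-liftS h) C) (renTm-subTm h z)
                                     (renTm-subTm (liftR-liftS (liftR-liftS h)) s) (renTm-subTm h t)
  renTm-subTm h (r t)            = cong r (renTm-subTm h t)
  renTm-subTm h (J C d a b p)    = congₙ 5 J (renTy-subTy (liftR-liftS (liftR-liftS (liftR-liftS h))) C)
                                     (renTm-subTm (liftR-liftS h) d) (renTm-subTm h a)
                                     (renTm-subTm h b) (renTm-subTm h p)

liftS-∘ : ∀ {m k l} {σ : Sub k l} {τ : Sub m k} {υ : Sub m l} →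
          (∀ i → subTm σ (τ i) ≡ υ i) → ∀ i → subTm (liftS σ) (liftS τ i) ≡ liftS υ i
liftS-∘ h zero = refl
liftS-∘ {τ = τ} h (suc i) =
  trans (subTm-renTm (λ _ → refl) (τ i)) (trans (sym (renTm-subTm (λ _ → refl) (τ i))) (cong wkTm (h i)))

mutual
  subTy-∘ : ∀ {m k l} {σ : Sub k l} {τ : Sub m k} {υ : Sub m l} →
            (∀ i → subTm σ (τ i) ≡ υ i) → ∀ A → subTy σ (subTy τ A) ≡ subTy υ A
  subTy-∘ h (Π A B)    = cong₂ Π (subTy-∘ h A) (subTy-∘ (liftS-∘ h) B)
  subTy-∘ h (Σ A B)    = cong₂ Σ (subTy-∘ h A) (subTy-∘ (liftS-∘ h) B)
  subTy-∘ h Nat        = refl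
  subTy-∘ h (Id A a b) = congₙ 3 Id (subTy-∘ h A) (subTm-∘ h a) (subTm-∘ h b)

  subTm-∘ : ∀ {m k l} {σ : Sub k l} {τ : Sub m k} {υ : Sub m l} →
            (∀ i → subTm σ (τ i) ≡ υ i) → ∀ t → subTm σ (subTm τ t) ≡ subTm υ t
  subTm-∘ h (var i)          = h i
  subTm-∘ h (lam t)          = cong lam (subTm-∘ (liftS-∘ h) t)
  subTm-∘ h (app t u)        = cong₂ app (subTm-∘ h t) (subTm-∘ h u)
  subTm-∘ h (pair t u)       = cong₂ pair (subTm-∘ h t) (subTm-∘ h u)
  subTm-∘ h (split C d t)    = congₙ 3 split (subTy-∘ (liftS-∘ h) C)
                                 (subTm-∘ (liftS-∘ (liftS-∘ h)) d) (subTm-∘ h t)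
  subTm-∘ h ze               = refl
  subTm-∘ h (su t)           = cong su (subTm-∘ h t)
  subTm-∘ h (natrec C z s t) = congₙ 4 natrec (subTy-∘ (liftS-∘ h) C) (subTm-∘ h z)
                                 (subTm-∘ (liftS-∘ (liftS-∘ h)) s) (subTm-∘ h t)
  subTm-∘ h (r t)            = cong r (subTm-∘ h t)
  subTm-∘ h (J C d a b p)    = congₙ 5 J (subTy-∘ (liftS-∘ (liftS-∘ (liftS-∘ h))) C)
                                 (subTm-∘ (liftS-∘ h) d) (subTm-∘ h a) (subTm-∘ h b) (subTm-∘ h p)

liftS-id : ∀ {m} {σ : Sub m m} → (∀ i → σ i ≡ var i) → ∀ i → liftS σ i ≡ var i
liftS-id h zero    = refl
liftS-id h (suc i) = cong wkTm (h i)

mutual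
  subTy-id : ∀ {m} {σ : Sub m m} → (∀ i → σ i ≡ var i) → ∀ A → subTy σ A ≡ A
  subTy-id h (Π A B)    = cong₂ Π (subTy-id h A) (subTy-id (liftS-id h) B)
  subTy-id h (Σ A B)    = cong₂ Σ (subTy-id h A) (subTy-id (liftS-id h) B)
  subTy-id h Nat        = refl
  subTy-id h (Id A a b) = congₙ 3 Id (subTy-id h A) (subTm-id h a) (subTm-id h b)

  subTm-id : ∀ {m} {σ : Sub m m} → (∀ i → σ i ≡ var i) → ∀ t → subTm σ t ≡ t
  subTm-id h (var i)          = h i
  subTm-id h (lam t)          = cong lam (subTm-id (liftS-id h) t)
  subTm-id h (app t u)        = cong₂ app (subTm-id h t) (subTm-id h u)
  subTm-id h (pair t u)       = cong₂ pair (subTm-id h t) (subTm-id h u)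
  subTm-id h (split C d t)    = congₙ 3 split (subTy-id (liftS-id h) C)
                                  (subTm-id (liftS-id (liftS-id h)) d) (subTm-id h t)
  subTm-id h ze               = refl
  subTm-id h (su t)           = cong su (subTm-id h t)
  subTm-id h (natrec C z s t) = congₙ 4 natrec (subTy-id (liftS-id h) C) (subTm-id h z)
                                  (subTm-id (liftS-id (liftS-id h)) s) (subTm-id h t)
  subTm-id h (r t)            = cong r (subTm-id h t)
  subTm-id h (J C d a b p)    = congₙ 5 J (subTy-id (liftS-id (liftS-id (liftS-id h))) C)
                                  (subTm-id (liftS-id h) d) (subTm-id h a) (subTm-id h b) (subTm-id h p)

renTy-as-subTy : ∀ {m k} (ρ : Ren m k) A → renTy ρ A ≡ subTy (λ i → var (ρ i)) A
renTy-as-subTy ρ A = trans (sym (subTy-id (λ _ → refl) (renTy ρ A))) (subTy-renTy (λ _ → refl) A)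

renTm-as-subTm : ∀ {m k} (ρ : Ren m k) t → renTm ρ t ≡ subTm (λ i → var (ρ i)) t
renTm-as-subTm ρ t = trans (sym (subTm-id (λ _ → refl) (renTm ρ t))) (subTm-renTm (λ _ → refl) t)

wk²Ty-as-subTy : ∀ {m} (A : Ty m) → wkTy (wkTy A) ≡ subTy wk2S A
wk²Ty-as-subTy A = trans (renTy-∘ (λ _ → refl) A) (renTy-as-subTy (λ i → suc (suc i)) A)

wk²Tm-as-subTm : ∀ {m} (t : Tm m) → wkTm (wkTm t) ≡ subTm wk2S t
wk²Tm-as-subTm t = trans (renTm-∘ (λ _ → refl) t) (renTm-as-subTm (λ i → suc (suc i)) t)

subTy-square : ∀ {m k l k′} {σ₁ : Sub k l} {σ₂ : Sub m k} {σ₃ : Sub k′ l} {σ₄ : Sub m k′} →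
               (∀ i → subTm σ₁ (σ₂ i) ≡ subTm σ₃ (σ₄ i)) →
               ∀ C → subTy σ₁ (subTy σ₂ C) ≡ subTy σ₃ (subTy σ₄ C)
subTy-square h C = trans (subTy-∘ h C) (sym (subTy-∘ (λ _ → refl) C))

subTm-square : ∀ {m k l k′} {σ₁ : Sub k l} {σ₂ : Sub m k} {σ₃ : Sub k′ l} {σ₄ : Sub m k′} →
               (∀ i → subTm σ₁ (σ₂ i) ≡ subTm σ₃ (σ₄ i)) →
               ∀ t → subTm σ₁ (subTm σ₂ t) ≡ subTm σ₃ (subTm σ₄ t)
subTm-square h t = trans (subTm-∘ h t) (sym (subTm-∘ (λ _ → refl) t))

subTy-,ˢ-wkTy : ∀ {m k} (σ : Sub m k) t A → subTy (σ ,ˢ t) (wkTy A) ≡ subTy σ A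
subTy-,ˢ-wkTy σ t A = subTy-renTy (λ _ → refl) A

liftS-wkTy : ∀ {m k} (σ : Sub m k) A → subTy (liftS σ) (wkTy A) ≡ wkTy (subTy σ A)
liftS-wkTy σ A =
  trans (subTy-renTy {τ = λ i → wkTm (σ i)} (λ _ → refl) A) (sym (renTy-subTy (λ _ → refl) A))

subTy-wk²Ty : ∀ {m k} {τ : Sub (suc (suc m)) k} {υ : Sub m k} →
              (∀ i → τ (suc (suc i)) ≡ υ i) → ∀ A → subTy τ (wkTy (wkTy A)) ≡ subTy υ A
subTy-wk²Ty {τ = τ} h A = trans (cong (subTy τ) (renTy-∘ (λ _ → refl) A)) (subTy-renTy h A)

subTm-wk²Tm : ∀ {m k} {τ : Sub (suc (suc m)) k} {υ : Sub m k} →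
              (∀ i → τ (suc (suc i)) ≡ υ i) → ∀ t → subTm τ (wkTm (wkTm t)) ≡ subTm υ t
subTm-wk²Tm {τ = τ} h t = trans (cong (subTm τ) (renTm-∘ (λ _ → refl) t)) (subTm-renTm h t)

subTy-wk³Ty : ∀ {m k} {τ : Sub (suc (suc (suc m))) k} {υ : Sub m k} →
              (∀ i → τ (suc (suc (suc i))) ≡ υ i) → ∀ A → subTy τ (wkTy (wkTy (wkTy A))) ≡ subTy υ A
subTy-wk³Ty {τ = τ} h A =
  trans (cong (subTy τ) (trans (renTy-∘ (λ _ → refl) (wkTy A)) (renTy-∘ (λ _ → refl) A))) (subTy-renTy h A)

subTm-wk³Tm : ∀ {m k} {τ : Sub (suc (suc (suc m))) k} {υ : Sub m k} →
              (∀ i → τ (suc (suc (suc i))) ≡ υ i) → ∀ t → subTm τ (wkTm (wkTm (wkTm t))) ≡ subTm υ t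
subTm-wk³Tm {τ = τ} h t =
  trans (cong (subTm τ) (trans (renTm-∘ (λ _ → refl) (wkTm t)) (renTm-∘ (λ _ → refl) t))) (subTm-renTm h t)

wkTy-[]₀ : ∀ {m} (A : Ty m) a → wkTy A [ a ]₀ ≡ A
wkTy-[]₀ A a = trans (subTy-renTy (λ _ → refl) A) (subTy-id (λ _ → refl) A)

wkTm-[]ₜ : ∀ {m} (t : Tm m) a → wkTm t [ a ]ₜ ≡ t
wkTm-[]ₜ t a = trans (subTm-renTm (λ _ → refl) t) (subTm-id (λ _ → refl) t)

wk²Ty-[]₂ : ∀ {m} (A : Ty m) a b → subTy ((idS ,ˢ a) ,ˢ b) (wkTy (wkTy A)) ≡ A
wk²Ty-[]₂ A a b = trans (subTy-wk²Ty (λ _ → refl) A) (subTy-id (λ _ → refl) A)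

subTy-[]₀ : ∀ {m k} (σ : Sub m k) B a → subTy σ (B [ a ]₀) ≡ subTy (liftS σ) B [ subTm σ a ]₀
subTy-[]₀ σ B a = subTy-square h B
  where h : ∀ i → subTm σ ((idS ,ˢ a) i) ≡ subTm (idS ,ˢ subTm σ a) (liftS σ i)
        h zero    = refl
        h (suc i) = sym (wkTm-[]ₜ (σ i) (subTm σ a))

subTm-[]ₜ : ∀ {m k} (σ : Sub m k) t a → subTm σ (t [ a ]ₜ) ≡ subTm (liftS σ) t [ subTm σ a ]ₜ
subTm-[]ₜ σ t a = subTm-square h t
  where h : ∀ i → subTm σ ((idS ,ˢ a) i) ≡ subTm (idS ,ˢ subTm σ a) (liftS σ i)
        h zero    = refl
        h (suc i) = sym (wkTm-[]ₜ (σ i) (subTm σ a))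

subTm-[]₂ : ∀ {m k} (σ : Sub m k) d a b →
            subTm σ (d [ a , b ]₂) ≡ subTm (liftS (liftS σ)) d [ subTm σ a , subTm σ b ]₂
subTm-[]₂ σ d a b = subTm-square h d
  where h : ∀ i → subTm σ (((idS ,ˢ a) ,ˢ b) i) ≡ subTm ((idS ,ˢ subTm σ a) ,ˢ subTm σ b) (liftS (liftS σ) i)
        h zero          = refl
        h (suc zero)    = refl
        h (suc (suc i)) = sym (trans (subTm-wk²Tm (λ _ → refl) (σ i)) (subTm-id (λ _ → refl) (σ i)))

subTy-[]₃ : ∀ {m k} (σ : Sub m k) C a b p →
            subTy σ (C [ a , b , p ]₃) ≡ subTy (liftS (liftS (liftS σ))) C [ subTm σ a , subTm σ b , subTm σ p ]₃
subTy-[]₃ σ C a b p = subTy-square h C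
  where h : ∀ i → subTm σ ((((idS ,ˢ a) ,ˢ b) ,ˢ p) i)
                ≡ subTm (((idS ,ˢ subTm σ a) ,ˢ subTm σ b) ,ˢ subTm σ p) (liftS (liftS (liftS σ)) i)
        h zero                = refl
        h (suc zero)          = refl
        h (suc (suc zero))    = refl
        h (suc (suc (suc i))) = sym (trans (subTm-wk³Tm (λ _ → refl) (σ i)) (subTm-id (λ _ → refl) (σ i)))

subTy-splitMotive : ∀ {m k} (σ : Sub m k) C →
                    subTy (liftS (liftS σ)) (splitMotive C) ≡ splitMotive (subTy (liftS σ) C)
subTy-splitMotive σ C = subTy-square h C
  where h : ∀ i → subTm (liftS (liftS σ)) ((wk2S ,ˢ pair (var (suc zero)) (var zero)) i)
                ≡ subTm (wk2S ,ˢ pair (var (suc zero)) (var zero)) (liftS σ i)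
        h zero    = refl
        h (suc i) = trans (wk²Tm-as-subTm (σ i)) (sym (subTm-renTm (λ _ → refl) (σ i)))

subTy-natrecMotive : ∀ {m k} (σ : Sub m k) C →
                     subTy (liftS (liftS σ)) (natrecMotive C) ≡ natrecMotive (subTy (liftS σ) C)
subTy-natrecMotive σ C = subTy-square h C
  where h : ∀ i → subTm (liftS (liftS σ)) ((wk2S ,ˢ su (var (suc zero))) i)
                ≡ subTm (wk2S ,ˢ su (var (suc zero))) (liftS σ i)
        h zero    = refl
        h (suc i) = trans (wk²Tm-as-subTm (σ i)) (sym (subTm-renTm (λ _ → refl) (σ i)))

subTy-JCtxId : ∀ {m k} (σ : Sub m k) A →
               subTy (liftS (liftS σ)) (Id (wkTy (wkTy A)) (var (suc zero)) (var zero))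
               ≡ Id (wkTy (wkTy (subTy σ A))) (var (suc zero)) (var zero)
subTy-JCtxId σ A = cong (λ T → Id T (var (suc zero)) (var zero))
  (trans (liftS-wkTy (liftS σ) (wkTy A)) (cong wkTy (liftS-wkTy σ A)))

diagS : ∀ {m} → Sub (suc (suc (suc m))) (suc m)
diagS = ((wk1S ,ˢ var zero) ,ˢ var zero) ,ˢ r (var zero)

subTy-JMotive : ∀ {m k} (σ : Sub m k) C →
                subTy (liftS σ) (JMotive C) ≡ JMotive (subTy (liftS (liftS (liftS σ))) C)
subTy-JMotive σ C = subTy-square h C
  where h : ∀ i → subTm (liftS σ) (diagS i) ≡ subTm diagS (liftS (liftS (liftS σ)) i)
        h zero                = refl
        h (suc zero)          = refl
        h (suc (suc zero))    = refl
        h (suc (suc (suc i))) = trans (renTm-as-subTm suc (σ i)) (sym (subTm-wk³Tm (λ _ → refl) (σ i)))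

splitMotive-[]₂ : ∀ {m} (a b : Tm m) C → subTy ((idS ,ˢ a) ,ˢ b) (splitMotive C) ≡ C [ pair a b ]₀
splitMotive-[]₂ a b C = subTy-∘ h C
  where h : ∀ i → subTm ((idS ,ˢ a) ,ˢ b) ((wk2S ,ˢ pair (var (suc zero)) (var zero)) i) ≡ (idS ,ˢ pair a b) i
        h zero    = refl
        h (suc i) = refl

natrecMotive-[]₂ : ∀ {m} (a b : Tm m) C → subTy ((idS ,ˢ a) ,ˢ b) (natrecMotive C) ≡ C [ su a ]₀
natrecMotive-[]₂ a b C = subTy-∘ h C
  where h : ∀ i → subTm ((idS ,ˢ a) ,ˢ b) ((wk2S ,ˢ su (var (suc zero))) i) ≡ (idS ,ˢ su a) i
        h zero    = refl
        h (suc i) = refl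

JMotive-[]₀ : ∀ {m} (a : Tm m) C → JMotive C [ a ]₀ ≡ C [ a , a , r a ]₃
JMotive-[]₀ a C = subTy-∘ h C
  where h : ∀ i → subTm (idS ,ˢ a) (diagS i) ≡ (((idS ,ˢ a) ,ˢ a) ,ˢ r a) i
        h zero                = refl
        h (suc zero)          = refl
        h (suc (suc zero))    = refl
        h (suc (suc (suc i))) = refl

renTel : ∀ {m k n} → Ren m k → Tel m n → Tel k n
renTel ρ []            = []
renTel ρ (t ▷ (a , b)) = renTel ρ t ▷ (renTm ρ a , renTm ρ b)

renTy-IdIter : ∀ {m k n} (ρ : Ren m k) A (tel : Tel m n) →
               renTy ρ (IdIter A tel) ≡ IdIter (renTy ρ A) (renTel ρ tel)
renTy-IdIter ρ A []            = refl
renTy-IdIter ρ A (t ▷ (a , b)) = cong (λ T → Id T (renTm ρ a) (renTm ρ b)) (renTy-IdIter ρ A t)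

subTel : ∀ {m k n} → Sub m k → Tel m n → Tel k n
subTel σ []            = []
subTel σ (t ▷ (a , b)) = subTel σ t ▷ (subTm σ a , subTm σ b)

subTy-IdIter : ∀ {m k n} (σ : Sub m k) A (tel : Tel m n) →
               subTy σ (IdIter A tel) ≡ IdIter (subTy σ A) (subTel σ tel)
subTy-IdIter σ A []            = refl
subTy-IdIter σ A (t ▷ (a , b)) = cong (λ T → Id T (subTm σ a) (subTm σ b)) (subTy-IdIter σ A t)

-- Id^{k+1}_A(a₁,b₁;…) read as Id^k_{Id A a₁ b₁}(a₂,b₂;…)
rebaseTy : ∀ {m k} → Ty m → Tel m (suc k) → Ty m
rebaseTy A ([] ▷ (a , b)) = Id A a b
rebaseTy A ((t ▷ x) ▷ y)  = rebaseTy A (t ▷ x)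

rebaseTel : ∀ {m k} → Ty m → Tel m (suc k) → Tel m k
rebaseTel A ([] ▷ _)      = []
rebaseTel A ((t ▷ x) ▷ y) = rebaseTel A (t ▷ x) ▷ y

IdIter-rebase : ∀ {m k} (A : Ty m) (tel : Tel m (suc k)) →
                IdIter A tel ≡ IdIter (rebaseTy A tel) (rebaseTel A tel)
IdIter-rebase A ([] ▷ _)            = refl
IdIter-rebase A ((t ▷ x) ▷ (a , b)) = cong (λ T → Id T a b) (IdIter-rebase A (t ▷ x))

module _ (X : Ext) where

  castHasTy : ∀ {m} {Γ : Ctx m} {t t′ A A′} → t ≡ t′ → A ≡ A′ → HasTy X Γ t A → HasTy X Γ t′ A′
  castHasTy refl refl d = d

  castWfT : ∀ {m} {Γ : Ctx m} {A A′} → A ≡ A′ → WfT X Γ A → WfT X Γ A′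
  castWfT refl d = d

  castEqT : ∀ {m} {Γ : Ctx m} {A A′ B B′} → A ≡ A′ → B ≡ B′ → EqT X Γ A B → EqT X Γ A′ B′
  castEqT refl refl d = d

  castEqTm : ∀ {m} {Γ : Ctx m} {t t′ u u′ A A′} →
             t ≡ t′ → u ≡ u′ → A ≡ A′ → EqTm X Γ t u A → EqTm X Γ t′ u′ A′
  castEqTm refl refl refl d = d

  retype : ∀ {m} {Γ : Ctx m} {t A A′} → A ≡ A′ → HasTy X Γ t A → HasTy X Γ t A′
  retype = castHasTy refl

  retypeEq : ∀ {m} {Γ : Ctx m} {t u A A′} → A ≡ A′ → EqTm X Γ t u A → EqTm X Γ t u A′
  retypeEq = castEqTm refl refl

  ctx-WfT : ∀ {m} {Γ : Ctx m} {A} → WfT X Γ A → WfC X Γ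
  ctx-WfT (Π-F w _)    = ctx-WfT w
  ctx-WfT (Σ-F w _)    = ctx-WfT w
  ctx-WfT (Nat-F w)    = w
  ctx-WfT (Id-F w _ _) = ctx-WfT w

  ctx-HasTy : ∀ {m} {Γ : Ctx m} {t A} → HasTy X Γ t A → WfC X Γ
  ctx-HasTy (var-I _ w)      = w
  ctx-HasTy (conv t _)       = ctx-HasTy t
  ctx-HasTy (Π-I w _)        = ctx-WfT w
  ctx-HasTy (Π-E f _)        = ctx-HasTy f
  ctx-HasTy (Σ-I _ a _)      = ctx-HasTy a
  ctx-HasTy (Σ-E _ _ t)      = ctx-HasTy t
  ctx-HasTy (Nat-I₀ w)       = w
  ctx-HasTy (Nat-I₁ t)       = ctx-HasTy t
  ctx-HasTy (Nat-E _ _ _ t)  = ctx-HasTy t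
  ctx-HasTy (Id-I a)         = ctx-HasTy a
  ctx-HasTy (Id-E _ _ a _ _) = ctx-HasTy a

  ctx-tail : ∀ {m} {Γ : Ctx m} {A} → WfC X (Γ ▹ A) → WfT X Γ A
  ctx-tail (▹-wf _ w) = w

  JCtx-head : ∀ {m} {Γ : Ctx m} {A} → WfC X (JCtx Γ A) → WfT X Γ A
  JCtx-head (▹-wf (▹-wf (▹-wf _ w) _) _) = w

  Σ-F-inv : ∀ {m} {Γ : Ctx m} {A B} → WfT X Γ (Σ A B) → WfT X Γ A × WfT X (Γ ▹ A) B
  Σ-F-inv (Σ-F wA wB) = wA , wB

  Π-F-inv : ∀ {m} {Γ : Ctx m} {A B} → WfT X Γ (Π A B) → WfT X Γ A × WfT X (Γ ▹ A) B
  Π-F-inv (Π-F wA wB) = wA , wB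

  -- Instantiated first to renamings and then, using weakening, to arbitrary substitutions.
  module Substitution
    (P     : ∀ {m k} → Ctx m → Ctx k → Sub m k → Set)
    (P-wf  : ∀ {m k} {Γ : Ctx m} {Δ : Ctx k} {σ} → P Γ Δ σ → WfC X Δ)
    (P-var : ∀ {m k} {Γ : Ctx m} {Δ : Ctx k} {σ} → P Γ Δ σ →
             ∀ i → HasTy X Δ (σ i) (subTy σ (lookup Γ i)))
    (P-lift : ∀ {m k} {Γ : Ctx m} {Δ : Ctx k} {σ} {A B} → P Γ Δ σ → B ≡ subTy σ A →
              WfT X Δ B → P (Γ ▹ A) (Δ ▹ B) (liftS σ))
    where

    mutual
      sub-WfT : ∀ {m k} {Γ : Ctx m} {Δ : Ctx k} {σ A} → P Γ Δ σ → WfT X Γ A → WfT X Δ (subTy σ A)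
      sub-WfT p (Π-F wA wB)   = Π-F (sub-WfT p wA) (sub-WfT (P-lift p refl (sub-WfT p wA)) wB)
      sub-WfT p (Σ-F wA wB)   = Σ-F (sub-WfT p wA) (sub-WfT (P-lift p refl (sub-WfT p wA)) wB)
      sub-WfT p (Nat-F _)     = Nat-F (P-wf p)
      sub-WfT p (Id-F wA a b) = Id-F (sub-WfT p wA) (sub-HasTy p a) (sub-HasTy p b)

      -- ctx-tail ∘ ctx-WfT would not pass the termination checker here
      sub-tail : ∀ {m k} {Γ : Ctx m} {Δ : Ctx k} {σ A B} → P Γ Δ σ → WfT X (Γ ▹ A) B →
                 WfT X Δ (subTy σ A)
      sub-tail p (Π-F w _)              = sub-tail p w
      sub-tail p (Σ-F w _)              = sub-tail p w
      sub-tail p (Id-F w _ _)           = sub-tail p w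
      sub-tail p (Nat-F (▹-wf _ wA))    = sub-WfT p wA

      lift-JCtx : ∀ {m k} {Γ : Ctx m} {Δ : Ctx k} {σ A C} → P Γ Δ σ → WfT X (JCtx Γ A) C →
                  P (JCtx Γ A) (JCtx Δ (subTy σ A)) (liftS (liftS (liftS σ)))
      lift-JCtx p (Π-F w _)    = lift-JCtx p w
      lift-JCtx p (Σ-F w _)    = lift-JCtx p w
      lift-JCtx p (Id-F w _ _) = lift-JCtx p w
      lift-JCtx {σ = σ} {A = A} p (Nat-F (▹-wf (▹-wf (▹-wf _ wA) wA′) wId)) = p₃
        where
          p₁ = P-lift p refl (sub-WfT p wA)
          p₂ = P-lift p₁ (sym (liftS-wkTy σ A)) (castWfT (liftS-wkTy σ A) (sub-WfT p₁ wA′))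
          p₃ = P-lift p₂ (sym (subTy-JCtxId σ A)) (castWfT (subTy-JCtxId σ A) (sub-WfT p₂ wId))

      sub-HasTy : ∀ {m k} {Γ : Ctx m} {Δ : Ctx k} {σ t A} → P Γ Δ σ → HasTy X Γ t A →
                  HasTy X Δ (subTm σ t) (subTy σ A)
      sub-HasTy p (var-I i _) = P-var p i
      sub-HasTy p (conv t e)  = conv (sub-HasTy p t) (sub-EqT p e)
      sub-HasTy p (Π-I wA t)  = Π-I (sub-WfT p wA) (sub-HasTy (P-lift p refl (sub-WfT p wA)) t)
      sub-HasTy {σ = σ} p (Π-E {B = B} {a = a} f x) =
        retype (sym (subTy-[]₀ σ B a)) (Π-E (sub-HasTy p f) (sub-HasTy p x))
      sub-HasTy {σ = σ} p (Σ-I {B = B} {a = a} wB x y) =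
        Σ-I (sub-WfT (P-lift p refl (sub-tail p wB)) wB) (sub-HasTy p x)
            (retype (subTy-[]₀ σ B a) (sub-HasTy p y))
      sub-HasTy {σ = σ} p (Σ-E {C = C} {t = t} wC d x) with Σ-F-inv (sub-tail p wC)
      ... | wA , wB = retype (sym (subTy-[]₀ σ C t))
            (Σ-E (sub-WfT (P-lift p refl (sub-tail p wC)) wC)
                 (retype (subTy-splitMotive σ C) (sub-HasTy (P-lift (P-lift p refl wA) refl wB) d))
                 (sub-HasTy p x))
      sub-HasTy p (Nat-I₀ _) = Nat-I₀ (P-wf p)
      sub-HasTy p (Nat-I₁ t) = Nat-I₁ (sub-HasTy p t)
      sub-HasTy {σ = σ} p (Nat-E {C = C} {t = t} wC z s x) =
        retype (sym (subTy-[]₀ σ C t))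
          (Nat-E wC′ (retype (subTy-[]₀ σ C ze) (sub-HasTy p z))
                 (retype (subTy-natrecMotive σ C) (sub-HasTy (P-lift pℕ refl wC′) s)) (sub-HasTy p x))
        where pℕ  = P-lift p refl (Nat-F (P-wf p))
              wC′ = sub-WfT pℕ wC
      sub-HasTy p (Id-I a) = Id-I (sub-HasTy p a)
      sub-HasTy {σ = σ} p (Id-E {C = C} {a = a} {b = b} {p = q} wC d x y z) =
        retype (sym (subTy-[]₃ σ C a b q))
          (Id-E (sub-WfT pJ wC)
                (retype (subTy-JMotive σ C) (sub-HasTy (P-lift p refl (JCtx-head (P-wf pJ))) d))
                (sub-HasTy p x) (sub-HasTy p y) (sub-HasTy p z))
        where pJ = lift-JCtx p wC

      sub-EqT : ∀ {m k} {Γ : Ctx m} {Δ : Ctx k} {σ A B} → P Γ Δ σ → EqT X Γ A B →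
                EqT X Δ (subTy σ A) (subTy σ B)
      sub-EqT p (reflT w)        = reflT (sub-WfT p w)
      sub-EqT p (symT e)         = symT (sub-EqT p e)
      sub-EqT p (transT e e′)    = transT (sub-EqT p e) (sub-EqT p e′)
      sub-EqT p (Π-cong wA e e′) = Π-cong wA′ (sub-EqT p e) (sub-EqT (P-lift p refl wA′) e′)
        where wA′ = sub-WfT p wA
      sub-EqT p (Σ-cong wA e e′) = Σ-cong wA′ (sub-EqT p e) (sub-EqT (P-lift p refl wA′) e′)
        where wA′ = sub-WfT p wA
      sub-EqT p (Id-cong e x y)  = Id-cong (sub-EqT p e) (sub-EqTm p x) (sub-EqTm p y)

      sub-EqTm : ∀ {m k} {Γ : Ctx m} {Δ : Ctx k} {σ t u A} → P Γ Δ σ → EqTm X Γ t u A →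
                 EqTm X Δ (subTm σ t) (subTm σ u) (subTy σ A)
      sub-EqTm p (reflE t)       = reflE (sub-HasTy p t)
      sub-EqTm p (symE e)        = symE (sub-EqTm p e)
      sub-EqTm p (transE e e′)   = transE (sub-EqTm p e) (sub-EqTm p e′)
      sub-EqTm p (convE e e′)    = convE (sub-EqTm p e) (sub-EqT p e′)
      sub-EqTm p (lam-cong wA e) = lam-cong (sub-WfT p wA) (sub-EqTm (P-lift p refl (sub-WfT p wA)) e)
      sub-EqTm {σ = σ} p (app-cong {B = B} {a = a} f x) =
        retypeEq (sym (subTy-[]₀ σ B a)) (app-cong (sub-EqTm p f) (sub-EqTm p x))
      sub-EqTm {σ = σ} p (pair-cong {B = B} {a = a} wB x y) =
        pair-cong (sub-WfT (P-lift p refl (sub-tail p wB)) wB) (sub-EqTm p x)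
                  (retypeEq (subTy-[]₀ σ B a) (sub-EqTm p y))
      sub-EqTm {σ = σ} p (split-cong {C = C} {t = t} wC eC d x) with Σ-F-inv (sub-tail p wC)
      ... | wA , wB = retypeEq (sym (subTy-[]₀ σ C t))
            (split-cong (sub-WfT pΣ wC) (sub-EqT pΣ eC)
                 (retypeEq (subTy-splitMotive σ C) (sub-EqTm (P-lift (P-lift p refl wA) refl wB) d))
                 (sub-EqTm p x))
        where pΣ = P-lift p refl (sub-tail p wC)
      sub-EqTm p (su-cong e) = su-cong (sub-EqTm p e)
      sub-EqTm {σ = σ} p (natrec-cong {C = C} {t = t} wC eC z s x) =
        retypeEq (sym (subTy-[]₀ σ C t))
          (natrec-cong wC′ (sub-EqT pℕ eC) (retypeEq (subTy-[]₀ σ C ze) (sub-EqTm p z))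
                 (retypeEq (subTy-natrecMotive σ C) (sub-EqTm (P-lift pℕ refl wC′) s)) (sub-EqTm p x))
        where pℕ  = P-lift p refl (Nat-F (P-wf p))
              wC′ = sub-WfT pℕ wC
      sub-EqTm p (r-cong e) = r-cong (sub-EqTm p e)
      sub-EqTm {σ = σ} p (J-cong {C = C} {a = a} {b = b} {p = q} wC eC d x y z) =
        retypeEq (sym (subTy-[]₃ σ C a b q))
          (J-cong (sub-WfT pJ wC) (sub-EqT pJ eC)
                  (retypeEq (subTy-JMotive σ C) (sub-EqTm (P-lift p refl (JCtx-head (P-wf pJ))) d))
                  (sub-EqTm p x) (sub-EqTm p y) (sub-EqTm p z))
        where pJ = lift-JCtx p wC
      sub-EqTm {σ = σ} p (Π-β {B = B} {t = t} {a = a} wA x y) =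
        castEqTm refl (sym (subTm-[]ₜ σ t a)) (sym (subTy-[]₀ σ B a))
          (Π-β (sub-WfT p wA) (sub-HasTy (P-lift p refl (sub-WfT p wA)) x) (sub-HasTy p y))
      sub-EqTm {σ = σ} p (Σ-β {B = B} {C = C} {d = d} {a = a} {b = b} wC x y z) with Σ-F-inv (sub-tail p wC)
      ... | wA , wB = castEqTm refl (sym (subTm-[]₂ σ d a b)) (sym (subTy-[]₀ σ C (pair a b)))
            (Σ-β (sub-WfT (P-lift p refl (sub-tail p wC)) wC)
                 (retype (subTy-splitMotive σ C) (sub-HasTy (P-lift (P-lift p refl wA) refl wB) x))
                 (sub-HasTy p y) (retype (subTy-[]₀ σ B a) (sub-HasTy p z)))
      sub-EqTm {σ = σ} p (Nat-β₀ {C = C} wC z s) =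
        retypeEq (sym (subTy-[]₀ σ C ze))
          (Nat-β₀ wC′ (retype (subTy-[]₀ σ C ze) (sub-HasTy p z))
                  (retype (subTy-natrecMotive σ C) (sub-HasTy (P-lift pℕ refl wC′) s)))
        where pℕ  = P-lift p refl (Nat-F (P-wf p))
              wC′ = sub-WfT pℕ wC
      sub-EqTm {σ = σ} p (Nat-β₁ {C = C} {z = z} {s = s} {t = t} wC x y w) =
        castEqTm refl (sym (subTm-[]₂ σ s t (natrec C z s t))) (sym (subTy-[]₀ σ C (su t)))
          (Nat-β₁ wC′ (retype (subTy-[]₀ σ C ze) (sub-HasTy p x))
                  (retype (subTy-natrecMotive σ C) (sub-HasTy (P-lift pℕ refl wC′) y)) (sub-HasTy p w))
        where pℕ  = P-lift p refl (Nat-F (P-wf p))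
              wC′ = sub-WfT pℕ wC
      sub-EqTm {σ = σ} p (Id-β {C = C} {d = d} {a = a} wC x y) =
        castEqTm refl (sym (subTm-[]ₜ σ d a)) (sym (subTy-[]₃ σ C a a (r a)))
          (Id-β (sub-WfT pJ wC)
                (retype (subTy-JMotive σ C) (sub-HasTy (P-lift p refl (JCtx-head (P-wf pJ))) x))
                (sub-HasTy p y))
        where pJ = lift-JCtx p wC
      sub-EqTm {σ = σ} p (TR-rule {A = A} {tel = tel} {a = a} {b = b} eq x y z) =
        retypeEq (sym (subTy-IdIter σ A tel))
          (TR-rule {A = subTy σ A} {tel = subTel σ tel} eq
             (retype (subTy-IdIter σ A tel) (sub-HasTy p x))
             (retype (subTy-IdIter σ A tel) (sub-HasTy p y))
             (retype (subTy-IdIter σ A (tel ▷ (a , b))) (sub-HasTy p z)))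
      sub-EqTm {σ = σ} p (UIP-rule {A = A} {tel = tel} eq x y) =
        retypeEq (sym (subTy-IdIter σ A tel))
          (UIP-rule {A = subTy σ A} {tel = subTel σ tel} eq
             (retype (subTy-IdIter σ A tel) (sub-HasTy p x))
             (retype (subTy-IdIter σ A tel) (sub-HasTy p y)))
      sub-EqTm {σ = σ} p (OUP-rule {A = A} {tel = tel} {a = a} eq x y) =
        retypeEq (sym (subTy-IdIter σ A (tel ▷ (a , a))))
          (OUP-rule {A = subTy σ A} {tel = subTel σ tel} eq
             (retype (subTy-IdIter σ A tel) (sub-HasTy p x))
             (retype (subTy-IdIter σ A (tel ▷ (a , a))) (sub-HasTy p y)))

  record WfRen {m k} (Γ : Ctx m) (Δ : Ctx k) (σ : Sub m k) : Set where
    constructor _,ʳ_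
    field
      ren-wf  : WfC X Δ
      ren-var : ∀ i → ∃ λ j → σ i ≡ var j × lookup Δ j ≡ subTy σ (lookup Γ i)
  open WfRen

  ren-HasTy : ∀ {m k} {Γ : Ctx m} {Δ : Ctx k} {σ} → WfRen Γ Δ σ →
              ∀ i → HasTy X Δ (σ i) (subTy σ (lookup Γ i))
  ren-HasTy (w ,ʳ f) i with f i
  ... | j , σi≡j , Δj≡ = castHasTy (sym σi≡j) Δj≡ (var-I j w)

  liftWfRen : ∀ {m k} {Γ : Ctx m} {Δ : Ctx k} {σ} {A B} → WfRen Γ Δ σ → B ≡ subTy σ A →
              WfT X Δ B → WfRen (Γ ▹ A) (Δ ▹ B) (liftS σ)
  liftWfRen {Γ = Γ} {σ = σ} {A = A} {B} (w ,ʳ f) B≡ wB = ▹-wf w wB ,ʳ g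
    where g : ∀ i → ∃ λ j → liftS σ i ≡ var j × lookup (_ ▹ B) j ≡ subTy (liftS σ) (lookup (Γ ▹ A) i)
          g zero = zero , refl , trans (cong wkTy B≡) (sym (liftS-wkTy σ A))
          g (suc i) with f i
          ... | j , σi≡j , Δj≡ =
            suc j , cong wkTm σi≡j , trans (cong wkTy Δj≡) (sym (liftS-wkTy σ (lookup Γ i)))

  module Rename = Substitution WfRen ren-wf ren-HasTy liftWfRen

  wk1WfRen : ∀ {m} {Δ : Ctx m} {B} → WfC X (Δ ▹ B) → WfRen Δ (Δ ▹ B) wk1S
  wk1WfRen {Δ = Δ} w = w ,ʳ λ i → suc i , refl , renTy-as-subTy suc (lookup Δ i)

  wk2WfRen : ∀ {m} {Γ : Ctx m} {A B} → WfC X ((Γ ▹ A) ▹ B) → WfRen Γ ((Γ ▹ A) ▹ B) wk2S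
  wk2WfRen {Γ = Γ} w = w ,ʳ λ i → suc (suc i) , refl , wk²Ty-as-subTy (lookup Γ i)

  wk-WfT : ∀ {m} {Δ : Ctx m} {A B} → WfC X (Δ ▹ B) → WfT X Δ A → WfT X (Δ ▹ B) (wkTy A)
  wk-WfT {A = A} w d = castWfT (sym (renTy-as-subTy suc A)) (Rename.sub-WfT (wk1WfRen w) d)

  wk-HasTy : ∀ {m} {Δ : Ctx m} {t A B} → WfC X (Δ ▹ B) → HasTy X Δ t A →
             HasTy X (Δ ▹ B) (wkTm t) (wkTy A)
  wk-HasTy {t = t} {A} w d =
    castHasTy (sym (renTm-as-subTm suc t)) (sym (renTy-as-subTy suc A)) (Rename.sub-HasTy (wk1WfRen w) d)

  wk-EqT : ∀ {m} {Δ : Ctx m} {A A′ B} → WfC X (Δ ▹ B) → EqT X Δ A A′ →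
           EqT X (Δ ▹ B) (wkTy A) (wkTy A′)
  wk-EqT {A = A} {A′} w d =
    castEqT (sym (renTy-as-subTy suc A)) (sym (renTy-as-subTy suc A′)) (Rename.sub-EqT (wk1WfRen w) d)

  wk-EqTm : ∀ {m} {Δ : Ctx m} {t u A B} → WfC X (Δ ▹ B) → EqTm X Δ t u A →
            EqTm X (Δ ▹ B) (wkTm t) (wkTm u) (wkTy A)
  wk-EqTm {t = t} {u} {A} w d =
    castEqTm (sym (renTm-as-subTm suc t)) (sym (renTm-as-subTm suc u)) (sym (renTy-as-subTy suc A))
      (Rename.sub-EqTm (wk1WfRen w) d)

  lookup-WfT : ∀ {m} {Γ : Ctx m} → WfC X Γ → ∀ i → WfT X Γ (lookup Γ i)
  lookup-WfT (▹-wf w wA) zero    = wk-WfT (▹-wf w wA) wA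
  lookup-WfT (▹-wf w wA) (suc i) = wk-WfT (▹-wf w wA) (lookup-WfT w i)

  record WfSub {m k} (Γ : Ctx m) (Δ : Ctx k) (σ : Sub m k) : Set where
    constructor _,ᵗ_
    field
      sub-wf  : WfC X Δ
      sub-var : ∀ i → HasTy X Δ (σ i) (subTy σ (lookup Γ i))
  open WfSub

  liftWfSub : ∀ {m k} {Γ : Ctx m} {Δ : Ctx k} {σ} {A B} → WfSub Γ Δ σ → B ≡ subTy σ A →
              WfT X Δ B → WfSub (Γ ▹ A) (Δ ▹ B) (liftS σ)
  liftWfSub {Γ = Γ} {σ = σ} {A = A} {B} (w ,ᵗ f) B≡ wB = wB′ ,ᵗ g
    where wB′ = ▹-wf w wB
          g : ∀ i → HasTy X (_ ▹ B) (liftS σ i) (subTy (liftS σ) (lookup (Γ ▹ A) i))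
          g zero    = retype (trans (cong wkTy B≡) (sym (liftS-wkTy σ A))) (var-I zero wB′)
          g (suc i) = retype (sym (liftS-wkTy σ (lookup Γ i))) (wk-HasTy wB′ (f i))

  module Subst = Substitution WfSub sub-wf sub-var liftWfSub

  WfRen⇒WfSub : ∀ {m k} {Γ : Ctx m} {Δ : Ctx k} {σ} → WfRen Γ Δ σ → WfSub Γ Δ σ
  WfRen⇒WfSub p = ren-wf p ,ᵗ ren-HasTy p

  idWfSub : ∀ {m} {Γ : Ctx m} → WfC X Γ → WfSub Γ Γ idS
  idWfSub {Γ = Γ} w = w ,ᵗ λ i → retype (sym (subTy-id (λ _ → refl) (lookup Γ i))) (var-I i w)

  extWfSub : ∀ {m k} {Γ : Ctx m} {Δ : Ctx k} {σ t A} → WfSub Γ Δ σ → HasTy X Δ t (subTy σ A) →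
             WfSub (Γ ▹ A) Δ (σ ,ˢ t)
  extWfSub {Γ = Γ} {σ = σ} {t = t} {A = A} (w ,ᵗ f) d = w ,ᵗ g
    where g : ∀ i → HasTy X _ ((σ ,ˢ t) i) (subTy (σ ,ˢ t) (lookup (Γ ▹ A) i))
          g zero    = retype (sym (subTy-,ˢ-wkTy σ t A)) d
          g (suc i) = retype (sym (subTy-,ˢ-wkTy σ t (lookup Γ i))) (f i)

  singleWfSub : ∀ {m} {Γ : Ctx m} {a A} → HasTy X Γ a A → WfSub (Γ ▹ A) Γ (idS ,ˢ a)
  singleWfSub {A = A} a = extWfSub (idWfSub (ctx-HasTy a)) (retype (sym (subTy-id (λ _ → refl) A)) a)

  tripleWfSub : ∀ {m} {Γ : Ctx m} {A a b p} → HasTy X Γ a A → HasTy X Γ b A → HasTy X Γ p (Id A a b) →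
                WfSub (JCtx Γ A) Γ (((idS ,ˢ a) ,ˢ b) ,ˢ p)
  tripleWfSub {A = A} {a} {b} ha hb hp =
    extWfSub (extWfSub (singleWfSub ha) (retype (sym (wkTy-[]₀ A a)) hb))
      (retype (cong (λ T → Id T a b) (sym (wk²Ty-[]₂ A a b))) hp)

  splitWfSub : ∀ {m} {Γ : Ctx m} {A B} → WfT X Γ A → WfT X (Γ ▹ A) B →
               WfSub (Γ ▹ Σ A B) ((Γ ▹ A) ▹ B) (wk2S ,ˢ pair (var (suc zero)) (var zero))
  splitWfSub {A = A} {B} wA wB = extWfSub p₂ (Σ-I wB₂ x y)
    where w₂  = ▹-wf (ctx-WfT wB) wB
          p₂  = WfRen⇒WfSub (wk2WfRen w₂)
          wB₂ = Subst.sub-WfT (liftWfSub p₂ refl (Subst.sub-WfT p₂ wA)) wB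
          x   = retype (wk²Ty-as-subTy A) (var-I (suc zero) w₂)
          h : ∀ i → subTm (idS ,ˢ var (suc zero)) (liftS wk2S i) ≡ var (suc i)
          h zero    = refl
          h (suc i) = refl
          y   = retype (trans (renTy-as-subTy suc B) (sym (subTy-∘ h B))) (var-I zero w₂)

  natrecWfSub : ∀ {m} {Γ : Ctx m} {C} → WfT X (Γ ▹ Nat) C →
                WfSub (Γ ▹ Nat) ((Γ ▹ Nat) ▹ C) (wk2S ,ˢ su (var (suc zero)))
  natrecWfSub wC = extWfSub (WfRen⇒WfSub (wk2WfRen w₂)) (Nat-I₁ (var-I (suc zero) w₂))
    where w₂ = ▹-wf (ctx-WfT wC) wC

  diagWfSub : ∀ {m} {Γ : Ctx m} {A} → WfT X Γ A → WfSub (JCtx Γ A) (Γ ▹ A) diagS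
  diagWfSub {A = A} wA = extWfSub (extWfSub (extWfSub p₁ x) x′) (Id-I x″)
    where w₁ = ▹-wf (ctx-WfT wA) wA
          p₁ = WfRen⇒WfSub (wk1WfRen w₁)
          x  = retype (renTy-as-subTy suc A) (var-I zero w₁)
          x′ = retype (trans (renTy-as-subTy suc A) (sym (subTy-,ˢ-wkTy wk1S (var zero) A))) (var-I zero w₁)
          x″ = retype (trans (renTy-as-subTy suc A) (sym (subTy-wk²Ty (λ _ → refl) A))) (var-I zero w₁)

  convCtxWfSub : ∀ {m} {Γ : Ctx m} {A A′} → WfT X Γ A′ → EqT X Γ A A′ → WfSub (Γ ▹ A) (Γ ▹ A′) idS
  convCtxWfSub {Γ = Γ} {A = A} {A′} wA′ e = w ,ᵗ g
    where w = ▹-wf (ctx-WfT wA′) wA′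
          g : ∀ i → HasTy X (Γ ▹ A′) (var i) (subTy idS (lookup (Γ ▹ A) i))
          g zero    = retype (sym (subTy-id (λ _ → refl) (wkTy A))) (conv (var-I zero w) (wk-EqT w (symT e)))
          g (suc i) = retype (sym (subTy-id (λ _ → refl) (wkTy (lookup Γ i)))) (var-I (suc i) w)

  convCtx-WfT : ∀ {m} {Γ : Ctx m} {A A′ B} → WfT X Γ A′ → EqT X Γ A A′ → WfT X (Γ ▹ A) B →
                WfT X (Γ ▹ A′) B
  convCtx-WfT {B = B} wA′ e wB = castWfT (subTy-id (λ _ → refl) B) (Subst.sub-WfT (convCtxWfSub wA′ e) wB)

  convCtx-HasTy : ∀ {m} {Γ : Ctx m} {A A′ B t} → WfT X Γ A′ → EqT X Γ A A′ → HasTy X (Γ ▹ A) t B →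
                  HasTy X (Γ ▹ A′) t B
  convCtx-HasTy {B = B} {t} wA′ e d =
    castHasTy (subTm-id (λ _ → refl) t) (subTy-id (λ _ → refl) B) (Subst.sub-HasTy (convCtxWfSub wA′ e) d)

  record WfSubEq {m k} (Γ : Ctx m) (Δ : Ctx k) (σ σ′ : Sub m k) : Set where
    constructor _,ᵉ_
    field
      eq-sub : WfSub Γ Δ σ
      eq-var : ∀ i → EqTm X Δ (σ i) (σ′ i) (subTy σ (lookup Γ i))
  open WfSubEq

  liftWfSubEq : ∀ {m k} {Γ : Ctx m} {Δ : Ctx k} {σ σ′} {A B} → WfSubEq Γ Δ σ σ′ → B ≡ subTy σ A →
                WfT X Δ B → WfSubEq (Γ ▹ A) (Δ ▹ B) (liftS σ) (liftS σ′)
  liftWfSubEq {Γ = Γ} {σ = σ} {σ′} {A = A} {B} (p ,ᵉ f) B≡ wB = liftWfSub p B≡ wB ,ᵉ g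
    where wB′ = ▹-wf (sub-wf p) wB
          g : ∀ i → EqTm X (_ ▹ B) (liftS σ i) (liftS σ′ i) (subTy (liftS σ) (lookup (Γ ▹ A) i))
          g zero    = retypeEq (trans (cong wkTy B≡) (sym (liftS-wkTy σ A))) (reflE (var-I zero wB′))
          g (suc i) = retypeEq (sym (liftS-wkTy σ (lookup Γ i))) (wk-EqTm wB′ (f i))

  liftWfSubEq-JCtx : ∀ {m k} {Γ : Ctx m} {Δ : Ctx k} {σ σ′} {A C} → WfSubEq Γ Δ σ σ′ →
                     WfT X (JCtx Γ A) C →
                     WfSubEq (JCtx Γ A) (JCtx Δ (subTy σ A)) (liftS (liftS (liftS σ))) (liftS (liftS (liftS σ′)))
  liftWfSubEq-JCtx {σ = σ} {A = A} q wC with sub-wf (Subst.lift-JCtx (eq-sub q) wC)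
  ... | ▹-wf (▹-wf (▹-wf _ wA) wA′) wId =
    liftWfSubEq (liftWfSubEq (liftWfSubEq q refl wA) (sym (liftS-wkTy σ A)) wA′) (sym (subTy-JCtxId σ A)) wId

  mutual
    subEq-WfT : ∀ {m k} {Γ : Ctx m} {Δ : Ctx k} {σ σ′ A} → WfSubEq Γ Δ σ σ′ → WfT X Γ A →
                EqT X Δ (subTy σ A) (subTy σ′ A)
    subEq-WfT q (Π-F wA wB)   = Π-cong wA′ (subEq-WfT q wA) (subEq-WfT (liftWfSubEq q refl wA′) wB)
      where wA′ = Subst.sub-WfT (eq-sub q) wA
    subEq-WfT q (Σ-F wA wB)   = Σ-cong wA′ (subEq-WfT q wA) (subEq-WfT (liftWfSubEq q refl wA′) wB)
      where wA′ = Subst.sub-WfT (eq-sub q) wA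
    subEq-WfT q (Nat-F _)     = reflT (Nat-F (sub-wf (eq-sub q)))
    subEq-WfT q (Id-F wA a b) = Id-cong (subEq-WfT q wA) (subEq-HasTy q a) (subEq-HasTy q b)

    subEq-HasTy : ∀ {m k} {Γ : Ctx m} {Δ : Ctx k} {σ σ′ t A} → WfSubEq Γ Δ σ σ′ → HasTy X Γ t A →
                  EqTm X Δ (subTm σ t) (subTm σ′ t) (subTy σ A)
    subEq-HasTy q (var-I i _) = eq-var q i
    subEq-HasTy q (conv t e)  = convE (subEq-HasTy q t) (Subst.sub-EqT (eq-sub q) e)
    subEq-HasTy q (Π-I wA t)  = lam-cong wA′ (subEq-HasTy (liftWfSubEq q refl wA′) t)
      where wA′ = Subst.sub-WfT (eq-sub q) wA
    subEq-HasTy {σ = σ} q (Π-E {B = B} {a = a} f x) =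
      retypeEq (sym (subTy-[]₀ σ B a)) (app-cong (subEq-HasTy q f) (subEq-HasTy q x))
    subEq-HasTy {σ = σ} q (Σ-I {B = B} {a = a} wB x y) =
      pair-cong (Subst.sub-WfT (liftWfSub (eq-sub q) refl wA′) wB) (subEq-HasTy q x)
                (retypeEq (subTy-[]₀ σ B a) (subEq-HasTy q y))
      where wA′ = Subst.sub-WfT (eq-sub q) (ctx-tail (ctx-WfT wB))
    subEq-HasTy {σ = σ} q (Σ-E {C = C} {t = t} wC d x) =
      retypeEq (sym (subTy-[]₀ σ C t))
        (split-cong (Subst.sub-WfT (eq-sub qΣ) wC) (subEq-WfT qΣ wC)
           (retypeEq (subTy-splitMotive σ C) (subEq-HasTy (liftWfSubEq (liftWfSubEq q refl wA) refl wB) d))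
           (subEq-HasTy q x))
      where wΣ = Subst.sub-WfT (eq-sub q) (ctx-tail (ctx-WfT wC))
            qΣ = liftWfSubEq q refl wΣ
            wA = proj₁ (Σ-F-inv wΣ)
            wB = proj₂ (Σ-F-inv wΣ)
    subEq-HasTy q (Nat-I₀ _) = reflE (Nat-I₀ (sub-wf (eq-sub q)))
    subEq-HasTy q (Nat-I₁ t) = su-cong (subEq-HasTy q t)
    subEq-HasTy {σ = σ} q (Nat-E {C = C} {t = t} wC z s x) =
      retypeEq (sym (subTy-[]₀ σ C t))
        (natrec-cong wC′ (subEq-WfT qℕ wC) (retypeEq (subTy-[]₀ σ C ze) (subEq-HasTy q z))
           (retypeEq (subTy-natrecMotive σ C) (subEq-HasTy (liftWfSubEq qℕ refl wC′) s)) (subEq-HasTy q x))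
      where qℕ  = liftWfSubEq q refl (Nat-F (sub-wf (eq-sub q)))
            wC′ = Subst.sub-WfT (eq-sub qℕ) wC
    subEq-HasTy q (Id-I a) = r-cong (subEq-HasTy q a)
    subEq-HasTy {σ = σ} q (Id-E {C = C} {a = a} {b = b} {p = p} wC d x y z) =
      retypeEq (sym (subTy-[]₃ σ C a b p))
        (J-cong (Subst.sub-WfT (eq-sub qJ) wC) (subEq-WfT qJ wC)
           (retypeEq (subTy-JMotive σ C)
              (subEq-HasTy (liftWfSubEq q refl (JCtx-head (sub-wf (eq-sub qJ)))) d))
           (subEq-HasTy q x) (subEq-HasTy q y) (subEq-HasTy q z))
      where qJ = liftWfSubEq-JCtx q wC

  idWfSubEq : ∀ {m} {Γ : Ctx m} → WfC X Γ → WfSubEq Γ Γ idS idS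
  idWfSubEq w = idWfSub w ,ᵉ λ i → reflE (sub-var (idWfSub w) i)

  extWfSubEq : ∀ {m k} {Γ : Ctx m} {Δ : Ctx k} {σ σ′ t t′ A} → WfSubEq Γ Δ σ σ′ →
               HasTy X Δ t (subTy σ A) → EqTm X Δ t t′ (subTy σ A) →
               WfSubEq (Γ ▹ A) Δ (σ ,ˢ t) (σ′ ,ˢ t′)
  extWfSubEq {Γ = Γ} {σ = σ} {σ′} {t} {t′} {A} q d e = extWfSub (eq-sub q) d ,ᵉ g
    where g : ∀ i → EqTm X _ ((σ ,ˢ t) i) ((σ′ ,ˢ t′) i) (subTy (σ ,ˢ t) (lookup (Γ ▹ A) i))
          g zero    = retypeEq (sym (subTy-,ˢ-wkTy σ t A)) e
          g (suc i) = retypeEq (sym (subTy-,ˢ-wkTy σ t (lookup Γ i))) (eq-var q i)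

  singleWfSubEq : ∀ {m} {Γ : Ctx m} {a a′ A} → HasTy X Γ a A → EqTm X Γ a a′ A →
                  WfSubEq (Γ ▹ A) Γ (idS ,ˢ a) (idS ,ˢ a′)
  singleWfSubEq {A = A} a e =
    extWfSubEq (idWfSubEq (ctx-HasTy a)) (retype A≡ a) (retypeEq A≡ e)
    where A≡ = sym (subTy-id (λ _ → refl) A)

  tripleWfSubEq : ∀ {m} {Γ : Ctx m} {A a a′ b b′ p p′} →
                  HasTy X Γ a A → EqTm X Γ a a′ A → HasTy X Γ b A → EqTm X Γ b b′ A →
                  HasTy X Γ p (Id A a b) → EqTm X Γ p p′ (Id A a b) →
                  WfSubEq (JCtx Γ A) Γ (((idS ,ˢ a) ,ˢ b) ,ˢ p) (((idS ,ˢ a′) ,ˢ b′) ,ˢ p′)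
  tripleWfSubEq {A = A} {a} {b = b} ha ea hb eb hp ep =
    extWfSubEq (extWfSubEq (singleWfSubEq ha ea) (retype A≡ hb) (retypeEq A≡ eb))
      (retype Id≡ hp) (retypeEq Id≡ ep)
    where A≡  = sym (wkTy-[]₀ A a)
          Id≡ = cong (λ T → Id T a b) (sym (wk²Ty-[]₂ A a b))

  []₀-EqT : ∀ {m} {Γ : Ctx m} {a a′ A B} → WfT X (Γ ▹ A) B → HasTy X Γ a A → EqTm X Γ a a′ A →
            EqT X Γ (B [ a ]₀) (B [ a′ ]₀)
  []₀-EqT wB a e = subEq-WfT (singleWfSubEq a e) wB

  mutual
    presup-HasTy : ∀ {m} {Γ : Ctx m} {t A} → HasTy X Γ t A → WfT X Γ A
    presup-HasTy (var-I i w)          = lookup-WfT w i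
    presup-HasTy (conv t e)           = proj₂ (presup-EqT e)
    presup-HasTy (Π-I wA t)           = Π-F wA (presup-HasTy t)
    presup-HasTy (Π-E f x)            = Subst.sub-WfT (singleWfSub x) (proj₂ (Π-F-inv (presup-HasTy f)))
    presup-HasTy (Σ-I wB x y)         = Σ-F (presup-HasTy x) wB
    presup-HasTy (Σ-E wC d x)         = Subst.sub-WfT (singleWfSub x) wC
    presup-HasTy (Nat-I₀ w)           = Nat-F w
    presup-HasTy (Nat-I₁ t)           = Nat-F (ctx-HasTy t)
    presup-HasTy (Nat-E wC z s x)     = Subst.sub-WfT (singleWfSub x) wC
    presup-HasTy (Id-I a)             = Id-F (presup-HasTy a) a a
    presup-HasTy (Id-E wC d x y z)    = Subst.sub-WfT (tripleWfSub x y z) wC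

    presup-EqT : ∀ {m} {Γ : Ctx m} {A B} → EqT X Γ A B → WfT X Γ A × WfT X Γ B
    presup-EqT (reflT w)         = w , w
    presup-EqT (symT e)          = proj₂ (presup-EqT e) , proj₁ (presup-EqT e)
    presup-EqT (transT e e′)     = proj₁ (presup-EqT e) , proj₂ (presup-EqT e′)
    presup-EqT (Π-cong wA e eB) with presup-EqT e | presup-EqT eB
    ... | _ , wA′ | wB , wB′ = Π-F wA wB , Π-F wA′ (convCtx-WfT wA′ e wB′)
    presup-EqT (Σ-cong wA e eB) with presup-EqT e | presup-EqT eB
    ... | _ , wA′ | wB , wB′ = Σ-F wA wB , Σ-F wA′ (convCtx-WfT wA′ e wB′)
    presup-EqT (Id-cong e x y) with presup-EqT e | presup-EqTm x | presup-EqTm y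
    ... | wA , wA′ | _ , hx , hx′ | _ , hy , hy′ = Id-F wA hx hy , Id-F wA′ (conv hx′ e) (conv hy′ e)

    presup-EqTm : ∀ {m} {Γ : Ctx m} {t u A} → EqTm X Γ t u A →
                  WfT X Γ A × HasTy X Γ t A × HasTy X Γ u A
    presup-EqTm (reflE t) = presup-HasTy t , t , t
    presup-EqTm (symE e) with presup-EqTm e
    ... | w , a , b = w , b , a
    presup-EqTm (transE e e′) with presup-EqTm e | presup-EqTm e′
    ... | w , a , _ | _ , _ , c = w , a , c
    presup-EqTm (convE e eT) with presup-EqTm e
    ... | _ , a , b = proj₂ (presup-EqT eT) , conv a eT , conv b eT
    presup-EqTm (lam-cong wA e) with presup-EqTm e
    ... | wB , a , b = Π-F wA wB , Π-I wA a , Π-I wA b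
    presup-EqTm (app-cong ef ex) with presup-EqTm ef | presup-EqTm ex
    ... | Π-F wA wB , f , f′ | _ , x , x′ =
      Subst.sub-WfT (singleWfSub x) wB , Π-E f x , conv (Π-E f′ x′) (symT ([]₀-EqT wB x ex))
    presup-EqTm (pair-cong wB ex ey) with presup-EqTm ex | presup-EqTm ey
    ... | wA , x , x′ | _ , y , y′ = Σ-F wA wB , Σ-I wB x y , Σ-I wB x′ (conv y′ ([]₀-EqT wB x ex))
    presup-EqTm (split-cong wC eC ed et) with presup-EqTm et | presup-EqT eC | presup-EqTm ed
    ... | Σ-F wA wB , t , t′ | _ , wC′ | _ , d , d′ =
      Subst.sub-WfT (singleWfSub t) wC , Σ-E wC d t ,
      conv (Σ-E wC′ (conv d′ (Subst.sub-EqT (splitWfSub wA wB) eC)) t′)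
           (symT (transT (Subst.sub-EqT (singleWfSub t) eC) ([]₀-EqT wC′ t et)))
    presup-EqTm (su-cong e) with presup-EqTm e
    ... | w , a , b = w , Nat-I₁ a , Nat-I₁ b
    presup-EqTm (natrec-cong wC eC ez es et) with presup-EqTm et | presup-EqT eC | presup-EqTm ez | presup-EqTm es
    ... | _ , t , t′ | _ , wC′ | _ , z , z′ | _ , s , s′ =
      Subst.sub-WfT (singleWfSub t) wC , Nat-E wC z s t ,
      conv (Nat-E wC′ (conv z′ (Subst.sub-EqT (singleWfSub (Nat-I₀ (ctx-HasTy t))) eC))
                      (convCtx-HasTy wC′ eC (conv s′ (Subst.sub-EqT (natrecWfSub wC) eC))) t′)
           (symT (transT (Subst.sub-EqT (singleWfSub t) eC) ([]₀-EqT wC′ t et)))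
    presup-EqTm (r-cong e) with presup-EqTm e
    ... | wA , a , a′ = Id-F wA a a , Id-I a , conv (Id-I a′) (Id-cong (reflT wA) (symE e) (symE e))
    presup-EqTm (J-cong wC eC ed ea eb ep)
      with presup-EqTm ea | presup-EqTm eb | presup-EqTm ep | presup-EqT eC | presup-EqTm ed
    ... | wA , a , a′ | _ , b , b′ | _ , p , p′ | _ , wC′ | _ , d , d′ =
      Subst.sub-WfT (tripleWfSub a b p) wC , Id-E wC d a b p ,
      conv (Id-E wC′ (conv d′ (Subst.sub-EqT (diagWfSub wA) eC)) a′ b′
                 (conv p′ (Id-cong (reflT wA) ea eb)))
           (symT (transT (Subst.sub-EqT (tripleWfSub a b p) eC) (subEq-WfT (tripleWfSubEq a ea b eb p ep) wC′)))
    presup-EqTm (Π-β wA t a) =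
      Subst.sub-WfT (singleWfSub a) (presup-HasTy t) , Π-E (Π-I wA t) a , Subst.sub-HasTy (singleWfSub a) t
    presup-EqTm (Σ-β {C = C} {a = a} {b = b} wC hd ha hb) with Σ-F-inv (ctx-tail (ctx-WfT wC))
    ... | wA , wB = Subst.sub-WfT (singleWfSub hab) wC , Σ-E wC hd hab ,
                    retype (splitMotive-[]₂ a b C) (Subst.sub-HasTy (extWfSub (singleWfSub ha) hb) hd)
      where hab = Σ-I wB ha hb
    presup-EqTm (Nat-β₀ wC z s) = Subst.sub-WfT (singleWfSub z0) wC , Nat-E wC z s z0 , z
      where z0 = Nat-I₀ (ctx-HasTy z)
    presup-EqTm (Nat-β₁ {C = C} {z = z} {s = s} {t = t} wC hz hs ht) =
      Subst.sub-WfT (singleWfSub (Nat-I₁ ht)) wC , Nat-E wC hz hs (Nat-I₁ ht) ,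
      retype (natrecMotive-[]₂ t (natrec C z s t) C)
        (Subst.sub-HasTy (extWfSub (singleWfSub ht) (Nat-E wC hz hs ht)) hs)
    presup-EqTm (Id-β {C = C} {a = a} wC hd ha) =
      Subst.sub-WfT (tripleWfSub ha ha (Id-I ha)) wC , Id-E wC hd ha ha (Id-I ha) ,
      retype (JMotive-[]₀ a C) (Subst.sub-HasTy (singleWfSub ha) hd)
    presup-EqTm (TR-rule _ x y _) = presup-HasTy x , x , y
    presup-EqTm (UIP-rule _ x y)  = presup-HasTy x , x , y
    presup-EqTm (OUP-rule _ x z)  = presup-HasTy z , z , Id-I x

  JCtx-wf : ∀ {m} {Γ : Ctx m} {A} → WfT X Γ A → WfC X (JCtx Γ A)
  JCtx-wf wA = ▹-wf w₂ (Id-F (wk-WfT w₂ (wk-WfT w₁ wA)) (var-I (suc zero) w₂) (var-I zero w₂))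
    where w₁ = ▹-wf (ctx-WfT wA) wA
          w₂ = ▹-wf w₁ (wk-WfT w₁ wA)

  module TR-consequences {n} (tr : TRHolds X n) where

    TR-at : ∀ {m} {Γ : Ctx m} {T A} {tel : Tel m n} {a b p} → T ≡ IdIter A tel →
            HasTy X Γ a T → HasTy X Γ b T → HasTy X Γ p (Id T a b) → EqTm X Γ a b T
    TR-at {A = A} {tel} refl = tr {A = A} {tel = tel}

    TR-suc-admissible : TRHolds X (suc n)
    TR-suc-admissible {A = A} {tel} = TR-at {A = rebaseTy A tel} {rebaseTel A tel} (IdIter-rebase A tel)

    loop≡refl : ∀ {m} {Γ : Ctx m} {A} {tel : Tel m n} {a p} →
                HasTy X Γ a (IdIter A tel) → HasTy X Γ p (Id (IdIter A tel) a a) →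
                ∃ λ q → HasTy X Γ q (Id (Id (IdIter A tel) a a) p (r a))
    loop≡refl {Γ = Γ} {A} {tel} {a} {p} ha hp = J C d a a p , retype C[a,a,p]≡ (Id-E wC hd ha ha hp)
      where
        T  = IdIter A tel
        T₃ = wkTy (wkTy (wkTy T))
        wT = presup-HasTy ha
        w₃ = JCtx-wf wT
        x₂ = var-I (suc (suc zero)) w₃
        x₁ = var-I (suc zero) w₃
        u  = var-I zero w₃
        wT₃ : WfT X (JCtx Γ T) T₃
        wT₃ = lookup-WfT w₃ (suc (suc zero))
        T₃≡ : T₃ ≡ IdIter (wkTy (wkTy (wkTy A))) (renTel suc (renTel suc (renTel suc tel)))
        T₃≡ = trans (cong (λ U → wkTy (wkTy U)) (renTy-IdIter suc A tel))
                (trans (cong wkTy (renTy-IdIter suc (wkTy A) (renTel suc tel)))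
                       (renTy-IdIter suc (wkTy (wkTy A)) (renTel suc (renTel suc tel))))
        x₂≡x₁ = TR-at {A = wkTy (wkTy (wkTy A))} {renTel suc (renTel suc (renTel suc tel))} T₃≡ x₂ x₁ u
        C  = Id (Id T₃ (var (suc (suc zero))) (var (suc zero))) (var zero) (r (var (suc (suc zero))))
        wC : WfT X (JCtx Γ T) C
        wC = Id-F (Id-F wT₃ x₂ x₁) u (conv (Id-I x₂) (Id-cong (reflT wT₃) (reflE x₂) x₂≡x₁))
        d  = r (r (var zero))
        diag-T₃ : subTy diagS T₃ ≡ wkTy T
        diag-T₃ = trans (subTy-wk³Ty (λ _ → refl) T) (sym (renTy-as-subTy suc T))
        hd : HasTy X (Γ ▹ T) d (JMotive C)
        hd = retype (cong (λ U → Id (Id U (var zero) (var zero)) (r (var zero)) (r (var zero)))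
                          (sym diag-T₃))
                    (Id-I (Id-I (var-I zero (▹-wf (ctx-WfT wT) wT))))
        C[a,a,p]≡ : C [ a , a , p ]₃ ≡ Id (Id T a a) p (r a)
        C[a,a,p]≡ = cong (λ U → Id (Id U a a) p (r a))
                      (trans (subTy-wk³Ty (λ _ → refl) T) (subTy-id (λ _ → refl) T))

    OUP-admissible : OUPHolds X n
    OUP-admissible {A = A} {tel} {a} ha hp =
      TR-suc-admissible {A = A} {tel ▷ (a , a)} hp (Id-I ha) (proj₂ (loop≡refl {A = A} {tel} ha hp))

    UIP-suc-admissible : UIPHolds X (suc n)
    UIP-suc-admissible {A = A} {tel ▷ (c , d)} hp hq with presup-HasTy hp
    ... | Id-F wT hc hd = convE (transE (OUP-admissible {A = A} {tel} hc (conv hp Id≡))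
                                        (symE (OUP-admissible {A = A} {tel} hc (conv hq Id≡))))
                                (symT Id≡)
      where Id≡ = Id-cong (reflT wT) (reflE hc) (symE (tr {A = A} {tel = tel} hc hd hp))

-- IdIter is not injective, so the implicit A and tel can never be inferred and must be
-- passed on by hand.
lemma3p11 : (n : ℕ)
    → OUPHolds (TR n) n × UIPHolds (TR n) (suc n) × TRHolds (UIP n) n
lemma3p11 n =
  (λ {_} {_} {A} {tel} → OUP-admissible {A = A} {tel = tel}) ,
  (λ {_} {_} {A} {tel} → UIP-suc-admissible {A = A} {tel = tel}) ,
  (λ {_} {_} {A} {tel} ha hb _ → UIP-rule {A = A} {tel = tel} refl ha hb)
  where open TR-consequences (TR n) (λ {_} {_} {A} {tel} → TR-rule {A = A} {tel = tel} refl)
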